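{- Let $G$ be a graph with a 2-separation $G_1,G_2$, let $\{i,j\}=V(G_1)\cap V(G_2)$, and let $u\in V(G_1)$ and $v\in V(G_2)$. Then \begin{align*} \mathcal{F}_G(u,v) =\ & \mathcal{F}_{G_1/ij}(u,ij)\,T(G_2) + \mathcal{F}_{G_2/ij}(v,ij)\,T(G_1)\\ & + \tfrac12\mathcal{F}_{G_1}(u,i)\mathcal{F}_{G_2}(v,j)+\tfrac12\mathcal{F}_{G_1}(u,j)\mathcal{F}_{G_2}(v,i)\\ & -\tfrac12\mathcal{F}_{G_1}(u,i)\mathcal{F}_{G_2}(v,i)-\tfrac12\mathcal{F}_{G_1}(u,j)\mathcal{F}_{G_2}(v,j)\\ & +\tfrac12\big(\mathcal{F}_{G_1}(u,i)+\mathcal{F}_{G_1}(u,j)\big)\mathcal{F}_{G_2}(i,j)\\ & +\tfrac12\mathcal{F}_{G_1}(i,j)\big(\mathcal{F}_{G_2}(v,i)+\mathcal{F}_{G_2}(v,j)\big)\\ & -\tfrac12\mathcal{F}_{G_1}(i,j)\,\mathcal{F}_{G_2}(i,j). \end{align*}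
   Context: Graphs are finite and undirected; multiple edges are allowed, loops are not. $T(G)$ denotes the number of spanning trees of $G$. For vertices $u,v$ of $G$, $\mathcal{F}_G(u,v)$ denotes the number of spanning forests of $G$ with exactly two components in which $u$ and $v$ lie in different components. A 2-separation of $G$ is a pair of subgraphs $G_1,G_2$ such that $V(G)=V(G_1)\cup V(G_2)$, $|V(G_1)\cap V(G_2)|=2$, $E(G)=E(G_1)\cup E(G_2)$ and $E(G_1)\cap E(G_2)=\emptyset$. For vertices $i,j$ of a graph $H$, $H/ij$ is the graph obtained by identifying $i$ and $j$ into a single vertex called $ij$: every edge $\{x,i\}$ or $\{x,j\}$ with $x\neq i,j$ is replaced by an edge $\{x,ij\}$ (so common neighbours give multiple edges), edges not meeting $i$ or $j$ remain, and edges between $i$ and $j$ disappear. If $u$ (resp. $v$) equals $i$ or $j$, in $H/ij$ it is interpreted as the vertex $ij$. -}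

module Defs where

open import Data.Nat using (ℕ; zero; suc; _≤_)
open import Data.Fin using (Fin; zero; suc; fromℕ; inject₁; punchOut; _≟_)
open import Data.Fin.Subset using (Subset; _∈_)
open import Data.List using (List; length; lookup; map; filter)
open import Data.Product using (Σ; _×_; _,_; proj₁; proj₂; ∃)
open import Data.Sum using (_⊎_)
open import Function using (_∘_)
open import Function.Definitions using (Injective)
open import Relation.Nullary using (¬_; Dec; yes; no)
open import Relation.Nullary.Decidable using (¬?; _×-dec_; _⊎-dec_)
open import Relation.Binary.PropositionalEquality using (_≡_; _≢_; refl; sym; trans; cong)

-- Finite multigraphs: vertices Fin n, edges a list of endpoint pairs.
-- Edges are identified by their position in the list, so repeated
-- pairs are distinct parallel edges.

record Graph : Set where
  constructor mkGraph
  field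
    n     : ℕ
    edges : List (Fin n × Fin n)

open Graph public

V : Graph → Set
V G = Fin (n G)

m : Graph → ℕ
m G = length (edges G)

E : Graph → Set
E G = Fin (m G)

src tgt : (G : Graph) → E G → V G
src G e = proj₁ (lookup (edges G) e)
tgt G e = proj₂ (lookup (edges G) e)

Loopless : Graph → Set
Loopless G = ∀ e → src G e ≢ tgt G e

Joins : (G : Graph) → E G → V G → V G → Set
Joins G e x y = (src G e ≡ x × tgt G e ≡ y) ⊎ (src G e ≡ y × tgt G e ≡ x)

-- Spanning subgraphs are given by a subset S of the edges.

data Reach (G : Graph) (S : Subset (m G)) : V G → V G → Set where
  here : ∀ {x} → Reach G S x x
  step : ∀ {x y z} (e : E G) → e ∈ S → Joins G e x y → Reach G S y z → Reach G S x z

record Cycle (G : Graph) (S : Subset (m G)) : Set where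
  field
    k       : ℕ
    k≥1     : 1 ≤ k
    vs      : Fin (suc k) → V G
    es      : Fin k → E G
    closed  : vs (fromℕ k) ≡ vs zero
    vs-inj  : Injective _≡_ _≡_ (vs ∘ inject₁)
    es-inj  : Injective _≡_ _≡_ es
    es-in   : ∀ t → es t ∈ S
    es-join : ∀ t → Joins G (es t) (vs (inject₁ t)) (vs (suc t))

Acyclic : (G : Graph) → Subset (m G) → Set
Acyclic G S = ¬ Cycle G S

SpanningTree : (G : Graph) → Subset (m G) → Set
SpanningTree G S = Acyclic G S × (∀ x y → Reach G S x y)

TwoForest : (G : Graph) → V G → V G → Subset (m G) → Set
TwoForest G u v S =
  Acyclic G S × ¬ Reach G S u v × (∀ x → Reach G S x u ⊎ Reach G S x v)

record Counts {M : ℕ} (P : Subset M → Set) (k : ℕ) : Set where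
  field
    enum          : Fin k → Subset M
    enum-inj      : Injective _≡_ _≡_ enum
    enum-sound    : ∀ a → P (enum a)
    enum-complete : ∀ S → P S → Σ (Fin k) λ a → enum a ≡ S

NumSpanningTrees : Graph → ℕ → Set
NumSpanningTrees G t = Counts (SpanningTree G) t

NumTwoForests : (G : Graph) → V G → V G → ℕ → Set
NumTwoForests G u v f = Counts (TwoForest G u v) f

-- Identification H/ij.  Vertex j is removed, i becomes ij; the map
-- merge sends every vertex of H to its image in H/ij.

merge : ∀ {k} (i j : Fin (suc k)) → i ≢ j → Fin (suc k) → Fin k
merge i j i≢j x with x ≟ j
... | yes _   = punchOut {i = j} {j = i} (λ eq → i≢j (sym eq))
... | no x≢j  = punchOut {i = j} {j = x} (λ eq → x≢j (sym eq))

private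
  notIJ : ∀ {k} (i j : Fin k) (e : Fin k × Fin k) →
          Dec (¬ ((proj₁ e ≡ i × proj₂ e ≡ j) ⊎ (proj₁ e ≡ j × proj₂ e ≡ i)))
  notIJ i j e = ¬? (((proj₁ e ≟ i) ×-dec (proj₂ e ≟ j)) ⊎-dec ((proj₁ e ≟ j) ×-dec (proj₂ e ≟ i)))

contract : (H : Graph) (i j : V H) → i ≢ j → Graph
contract (mkGraph zero es) () j i≢j
contract (mkGraph (suc k) es) i j i≢j =
  mkGraph k (map (λ e → merge i j i≢j (proj₁ e) , merge i j i≢j (proj₂ e))
                 (filter (notIJ i j) es))

contractV : (H : Graph) (i j : V H) (i≢j : i ≢ j) → V H → V (contract H i j i≢j)
contractV (mkGraph zero es) () j i≢j x
contractV (mkGraph (suc k) es) i j i≢j x = merge i j i≢j x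

-- 2-separation of G into G₁, G₂ (given as graphs embedded in G),
-- with V(G₁) ∩ V(G₂) = {i , j}; i is i₁ in G₁ and i₂ in G₂, similarly j.

record TwoSeparation (G G₁ G₂ : Graph) (i₁ j₁ : V G₁) (i₂ j₂ : V G₂) : Set where
  field
    φ₁ : V G₁ → V G
    φ₂ : V G₂ → V G
    φ₁-inj : Injective _≡_ _≡_ φ₁
    φ₂-inj : Injective _≡_ _≡_ φ₂
    ψ₁ : E G₁ → E G
    ψ₂ : E G₂ → E G
    ψ₁-inj : Injective _≡_ _≡_ ψ₁
    ψ₂-inj : Injective _≡_ _≡_ ψ₂
    ψ₁-ends : ∀ e → Joins G (ψ₁ e) (φ₁ (src G₁ e)) (φ₁ (tgt G₁ e))
    ψ₂-ends : ∀ e → Joins G (ψ₂ e) (φ₂ (src G₂ e)) (φ₂ (tgt G₂ e))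
    V-cover : ∀ x → (∃ λ a → φ₁ a ≡ x) ⊎ (∃ λ b → φ₂ b ≡ x)
    E-cover : ∀ e → (∃ λ a → ψ₁ a ≡ e) ⊎ (∃ λ b → ψ₂ b ≡ e)
    E-disj  : ∀ a b → ψ₁ a ≢ ψ₂ b
    i-glue : φ₁ i₁ ≡ φ₂ i₂
    j-glue : φ₁ j₁ ≡ φ₂ j₂
    i≢j    : i₁ ≢ j₁
    meet   : ∀ a b → φ₁ a ≡ φ₂ b → (a ≡ i₁ × b ≡ i₂) ⊎ (a ≡ j₁ × b ≡ j₂)

i₂≢j₂ : ∀ {G G₁ G₂ i₁ j₁ i₂ j₂} → TwoSeparation G G₁ G₂ i₁ j₁ i₂ j₂ → i₂ ≢ j₂
i₂≢j₂ sep eq = i≢j (φ₁-inj (trans i-glue (trans (cong φ₂ eq) (sym j-glue))))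
  where open TwoSeparation sep

module Submission where

-- Let F be a two-forest of G separating u ∈ G₁ from v ∈ G₂, with traces
-- F₁, F₂ on the pieces.  Connectivity of F is expressed through that of
-- F₁ and F₂ (a path either stays in one piece or passes through i or j),
-- so F is a two-forest iff (F₁, F₂) satisfies a condition on the pieces
-- alone.  That condition splits into five exclusive cases: F₁ a spanning
-- tree and F₂ a two-forest of G₂/ij separating v from ij; the mirror
-- case; or, in each piece, a two-forest of one of the classes "u apart
-- from the linked pair i, j", "i, j separated with u at i", "... at j",
-- combined with a compatible class on the other side.  Counting the cases
-- gives 𝓕_G(u,v) = T₁·𝓕_{G₂/ij} + 𝓕_{G₁/ij}·T₂ + x₁(y₂+z₂) + y₁(x₂+z₂)
-- + z₁(x₂+y₂), where x, y, z are the class sizes; since 𝓕(u,i) = x + z,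
-- 𝓕(u,j) = x + y and 𝓕(i,j) = y + z on each side, a ring identity gives
-- the theorem.  Connectivity is
-- only decided up to double negation, which suffices as the conclusion
-- is a decidable equation.

open import Defs
open import Data.Nat as ℕ using (ℕ; zero; suc; s≤s; z≤n)
open import Data.Integer using (ℤ; +_; _+_; _-_; _*_)
open import Data.Integer.Properties using (pos-*) renaming (_≟_ to _≟ℤ_)
open import Data.Integer.Tactic.RingSolver using (solve-∀)
open import Data.Bool using (Bool; true; false; if_then_else_)
import Data.Bool.Properties as Bool
open import Data.Fin as Fin using (Fin; zero; suc; fromℕ; inject₁; splitAt; join; combine; remQuot; punchIn)
open import Data.Fin.Properties using (cantor-schröder-bernstein; splitAt-join; join-splitAt;
  remQuot-combine; combine-remQuot; 0≢1+n; suc-injective; fromℕ≢inject₁; inject₁-injective; any?;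
  punchOut-injective; punchOut-cong; punchOut-punchIn; punchInᵢ≢i)
open import Data.Fin.Subset using (Subset; _∈_)
open import Data.List as List using (List; []; _∷_; map; filter)
open import Data.Vec using (Vec; []; _∷_; lookup; tabulate; head; tail)
open import Data.Vec.Properties using (≡-dec; []=⇒lookup; lookup⇒[]=; lookup∘tabulate; tabulate∘lookup; tabulate-cong)
open import Data.Product using (Σ; _×_; _,_; proj₁; proj₂; ∃; uncurry)
open import Data.Sum using (_⊎_; inj₁; inj₂; [_,_]′) renaming (map to ⊎-map)
open import Data.Empty using (⊥; ⊥-elim)
open import Data.Unit using (⊤; tt)
open import Function using (_∘_)
open import Function.Definitions using (Injective)
open import Relation.Nullary using (¬_; Dec; yes; no; does)
open import Relation.Nullary.Decidable using (¬?; _×-dec_; _⊎-dec_; decidable-stable; ¬¬-excluded-middle)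
open import Relation.Unary using (Decidable)
open import Relation.Binary.Structures using (IsEquivalence)
open import Relation.Binary.PropositionalEquality using (_≡_; _≢_; refl; sym; trans; cong; cong₂; subst; subst₂)

module _ {M : ℕ} where

  Counts-unique : ∀ {P : Subset M → Set} {k k′} → Counts P k → Counts P k′ → k ≡ k′
  Counts-unique C C′ = cantor-schröder-bernstein {f = into C C′} {g = into C′ C} (into-inj C C′) (into-inj C′ C)
    where
    open Counts
    into : ∀ {P : Subset M → Set} {a b} → Counts P a → Counts P b → Fin a → Fin b
    into A B x = proj₁ (enum-complete B (enum A x) (enum-sound A x))
    into-inj : ∀ {P : Subset M → Set} {a b} (A : Counts P a) (B : Counts P b) →
               ∀ {x y} → into A B x ≡ into A B y → x ≡ y
    into-inj A B {x} {y} eq = enum-inj A (trans (sym (proj₂ (enum-complete B (enum A x) (enum-sound A x))))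
      (trans (cong (enum B) eq) (proj₂ (enum-complete B (enum A y) (enum-sound A y)))))

  Counts-⇔ : ∀ {P Q : Subset M → Set} {k} → (∀ S → P S → Q S) → (∀ S → Q S → P S) → Counts P k → Counts Q k
  Counts-⇔ pq qp C = record
    { enum = enum ; enum-inj = enum-inj ; enum-sound = λ a → pq _ (enum-sound a)
    ; enum-complete = λ S q → enum-complete S (qp S q) }
    where open Counts C

  Counts-⊎ : ∀ {P Q : Subset M → Set} {a b} → (∀ S → P S → Q S → ⊥) →
             Counts P a → Counts Q b → Counts (λ S → P S ⊎ Q S) (a ℕ.+ b)
  Counts-⊎ {P} {Q} {a} {b} disjoint CP CQ = record
    { enum = enum′ ∘ splitAt a
    ; enum-inj = λ {x} {y} eq → trans (sym (join-splitAt a b x))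
        (trans (cong (join a b) (enum′-inj (splitAt a x) (splitAt a y) eq)) (join-splitAt a b y))
    ; enum-sound = sound ∘ splitAt a
    ; enum-complete = complete }
    where
    open Counts
    enum′ : Fin a ⊎ Fin b → Subset M
    enum′ = [ enum CP , enum CQ ]′
    enum′-inj : ∀ x y → enum′ x ≡ enum′ y → x ≡ y
    enum′-inj (inj₁ x) (inj₁ y) eq = cong inj₁ (enum-inj CP eq)
    enum′-inj (inj₁ x) (inj₂ y) eq = ⊥-elim (disjoint _ (enum-sound CP x) (subst Q (sym eq) (enum-sound CQ y)))
    enum′-inj (inj₂ x) (inj₁ y) eq = ⊥-elim (disjoint _ (enum-sound CP y) (subst Q eq (enum-sound CQ x)))
    enum′-inj (inj₂ x) (inj₂ y) eq = cong inj₂ (enum-inj CQ eq)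
    sound : ∀ x → P (enum′ x) ⊎ Q (enum′ x)
    sound (inj₁ x) = inj₁ (enum-sound CP x)
    sound (inj₂ x) = inj₂ (enum-sound CQ x)
    complete : ∀ S → P S ⊎ Q S → Σ (Fin (a ℕ.+ b)) λ c → enum′ (splitAt a c) ≡ S
    complete S (inj₁ p) = let (x , eq) = enum-complete CP S p in
      join a b (inj₁ x) , trans (cong enum′ (splitAt-join a b (inj₁ x))) eq
    complete S (inj₂ q) = let (y , eq) = enum-complete CQ S q in
      join a b (inj₂ y) , trans (cong enum′ (splitAt-join a b (inj₂ y))) eq

Counts-embed : ∀ {M M′} (pull : Subset M → Subset M′) (push : Subset M′ → Subset M) (Im : Subset M → Set) →
  (∀ S′ → pull (push S′) ≡ S′) → (∀ S → Im S → push (pull S) ≡ S) → (∀ S′ → Im (push S′)) →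
  ∀ {P k} → Counts P k → Counts (λ S → Im S × P (pull S)) k
Counts-embed pull push Im pull-push push-pull push-im {P} C = record
  { enum = push ∘ enum
  ; enum-inj = λ eq → enum-inj (trans (sym (pull-push _)) (trans (cong pull eq) (pull-push _)))
  ; enum-sound = λ a → push-im _ , subst P (sym (pull-push _)) (enum-sound a)
  ; enum-complete = λ S (im , p) → let (a , eq) = enum-complete (pull S) p in
      a , trans (cong push eq) (push-pull S im) }
  where open Counts C

Counts-× : ∀ {M M₁ M₂} (r₁ : Subset M → Subset M₁) (r₂ : Subset M → Subset M₂)
  (pair : Subset M₁ → Subset M₂ → Subset M) →
  (∀ S₁ S₂ → r₁ (pair S₁ S₂) ≡ S₁) → (∀ S₁ S₂ → r₂ (pair S₁ S₂) ≡ S₂) → (∀ S → pair (r₁ S) (r₂ S) ≡ S) →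
  ∀ {P₁ P₂ k₁ k₂} → Counts P₁ k₁ → Counts P₂ k₂ → Counts (λ S → P₁ (r₁ S) × P₂ (r₂ S)) (k₁ ℕ.* k₂)
Counts-× {M} r₁ r₂ pair r₁-pair r₂-pair pair-r {P₁} {P₂} {k₁} {k₂} C₁ C₂ = record
  { enum = enum′ ∘ remQuot k₂
  ; enum-inj = λ {x} {y} eq → trans (sym (combine-remQuot {k₁} k₂ x))
      (trans (cong (uncurry combine) (enum′-inj (remQuot k₂ x) (remQuot k₂ y) eq)) (combine-remQuot {k₁} k₂ y))
  ; enum-sound = λ c → subst P₁ (sym (r₁-pair _ _)) (enum-sound C₁ _) , subst P₂ (sym (r₂-pair _ _)) (enum-sound C₂ _)
  ; enum-complete = complete }
  where
  open Counts
  enum′ : Fin k₁ × Fin k₂ → Subset M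
  enum′ (a , b) = pair (enum C₁ a) (enum C₂ b)
  enum′-inj : ∀ x y → enum′ x ≡ enum′ y → x ≡ y
  enum′-inj (a , b) (a′ , b′) eq = cong₂ _,_
    (enum-inj C₁ (trans (sym (r₁-pair _ _)) (trans (cong r₁ eq) (r₁-pair _ _))))
    (enum-inj C₂ (trans (sym (r₂-pair _ _)) (trans (cong r₂ eq) (r₂-pair _ _))))
  complete : ∀ S → P₁ (r₁ S) × P₂ (r₂ S) → Σ (Fin (k₁ ℕ.* k₂)) λ c → enum′ (remQuot k₂ c) ≡ S
  complete S (p₁ , p₂) with enum-complete C₁ (r₁ S) p₁ | enum-complete C₂ (r₂ S) p₂
  ... | a , eq₁ | b , eq₂ = combine a b ,
    trans (cong enum′ (remQuot-combine a b)) (trans (cong₂ pair eq₁ eq₂) (pair-r S))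

countDecidable : ∀ M (P : Subset M → Set) → (∀ S → Dec (P S)) → Σ ℕ (Counts P)
countDecidable zero P P? with P? []
... | yes p = 1 , record { enum = λ _ → [] ; enum-inj = λ { {zero} {zero} _ → refl }
                         ; enum-sound = λ { zero → p } ; enum-complete = λ { [] _ → zero , refl } }
... | no ¬p = 0 , record { enum = λ () ; enum-inj = λ { {()} } ; enum-sound = λ ()
                         ; enum-complete = λ { [] p → ⊥-elim (¬p p) } }
countDecidable (suc M) P P? =
  let (k₁ , C₁) = countDecidable M (P ∘ (true ∷_)) (P? ∘ (true ∷_))
      (k₂ , C₂) = countDecidable M (P ∘ (false ∷_)) (P? ∘ (false ∷_))
  in k₁ ℕ.+ k₂ , Counts-⇔ fromHead toHead (Counts-⊎ headsDiffer (withHead true C₁) (withHead false C₂))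
  where
  HeadP : Bool → Subset (suc M) → Set
  HeadP b S = head S ≡ b × P (b ∷ tail S)
  withHead : ∀ b {k} → Counts (P ∘ (b ∷_)) k → Counts (HeadP b) k
  withHead b = Counts-embed tail (b ∷_) (λ S → head S ≡ b) (λ _ → refl) (λ { (_ ∷ _) refl → refl }) (λ _ → refl)
  headsDiffer : ∀ S → HeadP true S → HeadP false S → ⊥
  headsDiffer (true ∷ _) _ (() , _)
  headsDiffer (false ∷ _) (() , _) _
  fromHead : ∀ S → HeadP true S ⊎ HeadP false S → P S
  fromHead (_ ∷ _) (inj₁ (refl , p)) = p
  fromHead (_ ∷ _) (inj₂ (refl , p)) = p
  toHead : ∀ S → P S → HeadP true S ⊎ HeadP false S
  toHead (true ∷ _) p = inj₁ (refl , p)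
  toHead (false ∷ _) p = inj₂ (refl , p)

Counts-decidable : ∀ {M} {P : Subset M → Set} {k} → Counts P k → ∀ S → Dec (P S)
Counts-decidable {P = P} C S with any? (λ a → ≡-dec Bool._≟_ (Counts.enum C a) S)
... | yes (a , eq) = yes (subst P eq (Counts.enum-sound C a))
... | no ∄a = no λ p → ∄a (Counts.enum-complete C S p)

lookup⇒∈ : ∀ {M} {S : Subset M} {e} → lookup S e ≡ true → e ∈ S
lookup⇒∈ {S = S} {e} = lookup⇒[]= e S

_─_ : ∀ {M} → Subset M → Fin M → Subset M
S ─ e = tabulate (λ f → if does (f Fin.≟ e) then false else lookup S f)

∈─⁻ : ∀ {M} {S : Subset M} {e f} → f ∈ S ─ e → f ∈ S × f ≢ e
∈─⁻ {S = S} {e} {f} p with f Fin.≟ e | trans (sym (lookup∘tabulate (λ f → if does (f Fin.≟ e) then false else lookup S f) f)) ([]=⇒lookup p)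
... | yes _ | ()
... | no f≢e | f∈S = lookup⇒∈ f∈S , f≢e

∈─⁺ : ∀ {M} {S : Subset M} {e f} → f ∈ S → f ≢ e → f ∈ S ─ e
∈─⁺ {S = S} {e} {f} p f≢e = lookup⇒∈ (trans (lookup∘tabulate (λ f → if does (f Fin.≟ e) then false else lookup S f) f) (keep (f Fin.≟ e)))
  where
  keep : (d : Dec (f ≡ e)) → (if does d then false else lookup S f) ≡ true
  keep (yes f≡e) = ⊥-elim (f≢e f≡e)
  keep (no _) = []=⇒lookup p

restrict : ∀ {M M′} → (Fin M′ → Fin M) → Subset M → Subset M′
restrict ψ F = tabulate (λ a → lookup F (ψ a))

restrict⁺ : ∀ {M M′} {ψ : Fin M′ → Fin M} {F a} → ψ a ∈ F → a ∈ restrict ψ F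
restrict⁺ {ψ = ψ} {F} {a} p = lookup⇒∈ (trans (lookup∘tabulate (λ a → lookup F (ψ a)) a) ([]=⇒lookup p))

restrict⁻ : ∀ {M M′} {ψ : Fin M′ → Fin M} {F a} → a ∈ restrict ψ F → ψ a ∈ F
restrict⁻ {ψ = ψ} {F} {a} p = lookup⇒∈ (trans (sym (lookup∘tabulate (λ a → lookup F (ψ a)) a)) ([]=⇒lookup p))

module _ (G : Graph) where

  Joins-sym : ∀ {e x y} → Joins G e x y → Joins G e y x
  Joins-sym (inj₁ (s , t)) = inj₂ (s , t)
  Joins-sym (inj₂ (s , t)) = inj₁ (s , t)

  Joins-unique : ∀ {e x y x′ y′} → Joins G e x y → Joins G e x′ y′ → (x ≡ x′ × y ≡ y′) ⊎ (x ≡ y′ × y ≡ x′)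
  Joins-unique (inj₁ (a , b)) (inj₁ (c , d)) = inj₁ (trans (sym a) c , trans (sym b) d)
  Joins-unique (inj₁ (a , b)) (inj₂ (c , d)) = inj₂ (trans (sym a) c , trans (sym b) d)
  Joins-unique (inj₂ (a , b)) (inj₁ (c , d)) = inj₂ (trans (sym b) d , trans (sym a) c)
  Joins-unique (inj₂ (a , b)) (inj₂ (c , d)) = inj₁ (trans (sym b) d , trans (sym a) c)

  Joins-ends : ∀ e → Joins G e (src G e) (tgt G e)
  Joins-ends e = inj₁ (refl , refl)

  module _ {S : Subset (m G)} where

    Reach-trans : ∀ {x y z} → Reach G S x y → Reach G S y z → Reach G S x z
    Reach-trans here q = q
    Reach-trans (step e p j r) q = step e p j (Reach-trans r q)

    Reach-edge : ∀ {e x y} → e ∈ S → Joins G e x y → Reach G S x y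
    Reach-edge p j = step _ p j here

    Reach-sym : ∀ {x y} → Reach G S x y → Reach G S y x
    Reach-sym here = here
    Reach-sym (step e p j r) = Reach-trans (Reach-sym r) (Reach-edge p (Joins-sym j))

    length : ∀ {x y} → Reach G S x y → ℕ
    length here = zero
    length (step _ _ _ r) = suc (length r)

    vertices : ∀ {x y} (r : Reach G S x y) → Vec (V G) (suc (length r))
    vertices (here {x}) = x ∷ []
    vertices (step {x} _ _ _ r) = x ∷ vertices r

    edgeSeq : ∀ {x y} (r : Reach G S x y) → Vec (E G) (length r)
    edgeSeq here = []
    edgeSeq (step e _ _ r) = e ∷ edgeSeq r

    vertices-first : ∀ {x y} (r : Reach G S x y) → lookup (vertices r) zero ≡ x
    vertices-first here = refl
    vertices-first (step _ _ _ r) = refl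

    vertices-last : ∀ {x y} (r : Reach G S x y) → lookup (vertices r) (fromℕ (length r)) ≡ y
    vertices-last here = refl
    vertices-last (step _ _ _ r) = vertices-last r

    edgeSeq-joins : ∀ {x y} (r : Reach G S x y) t →
      Joins G (lookup (edgeSeq r) t) (lookup (vertices r) (inject₁ t)) (lookup (vertices r) (suc t))
    edgeSeq-joins (step e p j r) zero = subst (Joins G e _) (sym (vertices-first r)) j
    edgeSeq-joins (step e p j r) (suc t) = edgeSeq-joins r t

    edgeSeq-∈ : ∀ {x y} (r : Reach G S x y) t → lookup (edgeSeq r) t ∈ S
    edgeSeq-∈ (step e p j r) zero = p
    edgeSeq-∈ (step e p j r) (suc t) = edgeSeq-∈ r t

    Visits : V G → ∀ {x y} → Reach G S x y → Set
    Visits z r = ∃ λ t → lookup (vertices r) t ≡ z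

    Simple : ∀ {x y} → Reach G S x y → Set
    Simple here = ⊤
    Simple (step {x} _ _ _ r) = ¬ Visits x r × Simple r

    suffix : ∀ {a y} (r : Reach G S a y) → Simple r → ∀ {x} → Visits x r → Σ (Reach G S x y) Simple
    suffix here s (zero , refl) = here , tt
    suffix (step e p j r) s (zero , refl) = step e p j r , s
    suffix (step e p j r) s (suc t , eq) = suffix r (proj₂ s) (t , eq)

    simplify : ∀ {x y} → Reach G S x y → Σ (Reach G S x y) Simple
    simplify here = here , tt
    simplify (step {x} e p j r) with simplify r
    ... | r′ , s′ with any? (λ t → lookup (vertices r′) t Fin.≟ x)
    ... | yes visits = suffix r′ s′ visits
    ... | no ¬visits = step e p j r′ , ¬visits , s′

    simple-vertices-inj : ∀ {x y} (r : Reach G S x y) → Simple r →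
      ∀ {a b} → lookup (vertices r) a ≡ lookup (vertices r) b → a ≡ b
    simple-vertices-inj here s {zero} {zero} eq = refl
    simple-vertices-inj (step e p j r) s {zero} {zero} eq = refl
    simple-vertices-inj (step e p j r) s {zero} {suc b} eq = ⊥-elim (proj₁ s (b , sym eq))
    simple-vertices-inj (step e p j r) s {suc a} {zero} eq = ⊥-elim (proj₁ s (a , eq))
    simple-vertices-inj (step e p j r) s {suc a} {suc b} eq = cong suc (simple-vertices-inj r (proj₂ s) eq)

    -- a simple walk uses no edge twice: a repeated edge would revisit its start
    simple-edges-inj : ∀ {x y} (r : Reach G S x y) → Simple r →
      ∀ {a b} → lookup (edgeSeq r) a ≡ lookup (edgeSeq r) b → a ≡ b
    simple-edges-inj (step e p j r) s {zero} {zero} eq = refl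
    simple-edges-inj (step e p j r) s {zero} {suc b} eq
      with Joins-unique (subst (λ f → Joins G f _ _) (sym eq) (edgeSeq-joins r b)) j
    ... | inj₁ (revisit , _) = ⊥-elim (proj₁ s (inject₁ b , revisit))
    ... | inj₂ (_ , revisit) = ⊥-elim (proj₁ s (suc b , revisit))
    simple-edges-inj (step e p j r) s {suc a} {zero} eq = sym (simple-edges-inj (step e p j r) s {zero} {suc a} (sym eq))
    simple-edges-inj (step e p j r) s {suc a} {suc b} eq = cong suc (simple-edges-inj r (proj₂ s) eq)

  Reach-mono : ∀ {S S′ : Subset (m G)} → (∀ e → e ∈ S → e ∈ S′) → ∀ {x y} → Reach G S x y → Reach G S′ x y
  Reach-mono S⊆S′ here = here
  Reach-mono S⊆S′ (step e p j r) = step e (S⊆S′ e p) j (Reach-mono S⊆S′ r)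

  Reach-avoid : ∀ {S : Subset (m G)} {e x y} (r : Reach G S x y) → (∀ t → lookup (edgeSeq r) t ≢ e) → Reach G (S ─ e) x y
  Reach-avoid here _ = here
  Reach-avoid (step f p j r) avoids = step f (∈─⁺ p (avoids zero)) j (Reach-avoid r (avoids ∘ suc))

  walkAlong : ∀ {S : Subset (m G)} n (w : Fin (suc n) → V G) (f : Fin n → E G) → (∀ t → f t ∈ S) →
              (∀ t → Joins G (f t) (w (inject₁ t)) (w (suc t))) → Reach G S (w zero) (w (fromℕ n))
  walkAlong zero w f f∈S joins = here
  walkAlong (suc n) w f f∈S joins =
    step (f zero) (f∈S zero) (joins zero) (walkAlong n (w ∘ suc) (f ∘ suc) (f∈S ∘ suc) (joins ∘ suc))

  closeCycle : ∀ {S : Subset (m G)} {e x y} → e ∈ S → Joins G e x y → (r : Reach G (S ─ e) y x) → Simple r → Cycle G S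
  closeCycle {S} {e} {x} {y} e∈S joins r simple = record
    { k = suc (length r) ; k≥1 = s≤s z≤n
    ; vs = vs ; es = es
    ; closed = vertices-last r
    ; vs-inj = vs-inj ; es-inj = es-inj ; es-in = es-in ; es-join = es-join }
    where
    vs : Fin (suc (suc (length r))) → V G
    vs = lookup (x ∷ vertices r)
    es : Fin (suc (length r)) → E G
    es = lookup (e ∷ edgeSeq r)
    vs-inj : ∀ {a b} → vs (inject₁ a) ≡ vs (inject₁ b) → a ≡ b
    vs-inj {zero} {zero} eq = refl
    vs-inj {zero} {suc b} eq = ⊥-elim (fromℕ≢inject₁ (simple-vertices-inj r simple (trans (vertices-last r) eq)))
    vs-inj {suc a} {zero} eq = ⊥-elim (fromℕ≢inject₁ (simple-vertices-inj r simple (trans (vertices-last r) (sym eq))))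
    vs-inj {suc a} {suc b} eq = cong suc (inject₁-injective (simple-vertices-inj r simple eq))
    es-inj : ∀ {a b} → es a ≡ es b → a ≡ b
    es-inj {zero} {zero} eq = refl
    es-inj {zero} {suc b} eq = ⊥-elim (proj₂ (∈─⁻ {S = S} (edgeSeq-∈ r b)) (sym eq))
    es-inj {suc a} {zero} eq = ⊥-elim (proj₂ (∈─⁻ {S = S} (edgeSeq-∈ r a)) eq)
    es-inj {suc a} {suc b} eq = cong suc (simple-edges-inj r simple eq)
    es-in : ∀ t → es t ∈ S
    es-in zero = e∈S
    es-in (suc t) = proj₁ (∈─⁻ {S = S} (edgeSeq-∈ r t))
    es-join : ∀ t → Joins G (es t) (vs (inject₁ t)) (vs (suc t))
    es-join zero = subst (Joins G e x) (sym (vertices-first r)) joins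
    es-join (suc t) = edgeSeq-joins r t

  Bridges : Subset (m G) → Set
  Bridges S = ∀ e {x y} → e ∈ S → Joins G e x y → ¬ Reach G (S ─ e) x y

  Acyclic⇒Bridges : ∀ {S} → Acyclic G S → Bridges S
  Acyclic⇒Bridges acyclic e e∈S joins r =
    let (r′ , simple) = simplify (Reach-sym r) in acyclic (closeCycle e∈S joins r′ simple)

  Bridges⇒Acyclic : ∀ {S} → Bridges S → Acyclic G S
  Bridges⇒Acyclic bridges record { k = zero ; k≥1 = () }
  Bridges⇒Acyclic {S} bridges record { k = suc k ; vs = vs ; es = es ; closed = closed
                                     ; es-inj = es-inj ; es-in = es-in ; es-join = es-join } =
    bridges (es zero) (es-in zero) (es-join zero) (Reach-sym rest)
    where
    others-∈ : ∀ t → es (suc t) ∈ S ─ es zero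
    others-∈ t = ∈─⁺ (es-in (suc t)) (λ eq → 0≢1+n (sym (es-inj eq)))
    rest : Reach G (S ─ es zero) (vs (suc zero)) (vs zero)
    rest = subst (Reach G _ _) closed (walkAlong k (vs ∘ suc) (es ∘ suc) others-∈ (es-join ∘ suc))

  bridge-ends : ∀ {S : Subset (m G)} {e x y x′ y′} → Joins G e x y → Joins G e x′ y′ →
                ¬ Reach G (S ─ e) x y → ¬ Reach G (S ─ e) x′ y′
  bridge-ends j j′ ¬r r′ with Joins-unique j j′
  ... | inj₁ (refl , refl) = ¬r r′
  ... | inj₂ (refl , refl) = ¬r (Reach-sym r′)

  firstEdge : ∀ {S : Subset (m G)} {a b} → Reach G S a b → a ≢ b →
              Σ (E G) λ e → Σ (V G) λ w → e ∈ S × Joins G e a w × Reach G (S ─ e) w b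
  firstEdge r a≢b with simplify r
  ... | here , _ = ⊥-elim (a≢b refl)
  ... | step e p j r₁ , s = e , _ , p , j ,
          Reach-avoid r₁ (λ t eq → 0≢1+n (simple-edges-inj (step e p j r₁) s {zero} {suc t} (sym eq)))

mapJoins : ∀ (H K : Graph) (φ : V H → V K) {e : E H} {e′ : E K} {x y} →
  Joins K e′ (φ (src H e)) (φ (tgt H e)) → Joins H e x y → Joins K e′ (φ x) (φ y)
mapJoins H K φ j (inj₁ (s , t)) = subst₂ (Joins K _) (cong φ s) (cong φ t) j
mapJoins H K φ j (inj₂ (s , t)) = Joins-sym K (subst₂ (Joins K _) (cong φ s) (cong φ t) j)

mapReach : ∀ (H K : Graph) (φ : V H → V K) {S : Subset (m H)} {S′ : Subset (m K)} →
  (∀ e → e ∈ S → Σ (E K) λ e′ → e′ ∈ S′ × Joins K e′ (φ (src H e)) (φ (tgt H e))) →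
  ∀ {x y} → Reach H S x y → Reach K S′ (φ x) (φ y)
mapReach H K φ image here = here
mapReach H K φ image (step e p j r) =
  let (e′ , p′ , j′) = image e p in step e′ p′ (mapJoins H K φ j′ j) (mapReach H K φ image r)

mapCycle : ∀ (H K : Graph) (φ : V H → V K) (ψ : E H → E K) → Injective _≡_ _≡_ φ →
  Injective _≡_ _≡_ ψ → (∀ e → Joins K (ψ e) (φ (src H e)) (φ (tgt H e))) →
  ∀ {S S′} → (∀ e → e ∈ S → ψ e ∈ S′) → Cycle H S → Cycle K S′
mapCycle H K φ ψ φ-inj ψ-inj ψ-ends S⊆S′ c = record
  { k = k ; k≥1 = k≥1 ; vs = φ ∘ vs ; es = ψ ∘ es ; closed = cong φ closed
  ; vs-inj = vs-inj ∘ φ-inj ; es-inj = es-inj ∘ ψ-inj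
  ; es-in = λ t → S⊆S′ _ (es-in t) ; es-join = λ t → mapJoins H K φ (ψ-ends (es t)) (es-join t) }
  where open Cycle c

-- Connectivity in a graph glued from two pieces along i₁ = i₂ and
-- j₁ = j₂, expressed through the connectivities r₁, r₂ of the pieces: a
-- path between two vertices of piece 1 either stays in piece 1 or makes
-- one excursion through piece 2 from i to j; a path from piece 1 to
-- piece 2 crosses at i or at j.

module _ {V₁ V₂ : Set} (r₁ : V₁ → V₁ → Set) (r₂ : V₂ → V₂ → Set) (i₁ j₁ : V₁) (i₂ j₂ : V₂) where

  GluedWithin : V₁ → V₁ → Set
  GluedWithin x y = r₁ x y ⊎ (r₁ x i₁ × r₁ j₁ y × r₂ i₂ j₂) ⊎ (r₁ x j₁ × r₁ i₁ y × r₂ i₂ j₂)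

  GluedAcross : V₁ → V₂ → Set
  GluedAcross x y = (r₁ x i₁ × r₂ i₂ y) ⊎ (r₁ x j₁ × r₂ j₂ y)

GluedWithin-unlinked : ∀ {V₁ V₂ : Set} {r₁ : V₁ → V₁ → Set} {r₂ : V₂ → V₂ → Set} {i₁ j₁ i₂ j₂} →
  ¬ r₂ i₂ j₂ → ∀ {x y} → GluedWithin r₁ r₂ i₁ j₁ i₂ j₂ x y → r₁ x y
GluedWithin-unlinked ¬ij₂ (inj₁ r) = r
GluedWithin-unlinked ¬ij₂ (inj₂ (inj₁ (_ , _ , ij₂))) = ⊥-elim (¬ij₂ ij₂)
GluedWithin-unlinked ¬ij₂ (inj₂ (inj₂ (_ , _ , ij₂))) = ⊥-elim (¬ij₂ ij₂)

ReachModulo : ∀ {W : Set} → (W → W → Set) → W → W → W → W → Set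
ReachModulo r i j x y = r x y ⊎ (r x i × r j y) ⊎ (r x j × r i y)

-- S has no i–j path and becomes a two-forest separating u from the merged
-- vertex ij once i and j are identified (A says that S is acyclic)
ContractedTwoForest : ∀ {W : Set} → (W → W → Set) → Set → W → W → W → Set
ContractedTwoForest r A u i j =
  A × ¬ r i j × ¬ ReachModulo r i j u i × (∀ x → ReachModulo r i j x u ⊎ ReachModulo r i j x i)

-- The two-forest condition for the union of the pieces with u in piece 1
-- and v in piece 2, read off from the pieces (A₁, A₂ say that the pieces
-- are acyclic): no cycle through both pieces, u and v not connected, and
-- every vertex of either piece connected to u or to v.
module _ {V₁ V₂ : Set} (r₁ : V₁ → V₁ → Set) (r₂ : V₂ → V₂ → Set) (i₁ j₁ : V₁) (i₂ j₂ : V₂) where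

  GluedTwoForest : (A₁ A₂ : Set) → V₁ → V₂ → Set
  GluedTwoForest A₁ A₂ u v =
    A₁ × A₂ × ¬ (r₁ i₁ j₁ × r₂ i₂ j₂) × ¬ GluedAcross r₁ r₂ i₁ j₁ i₂ j₂ u v ×
    (∀ x → GluedWithin r₁ r₂ i₁ j₁ i₂ j₂ x u ⊎ GluedAcross r₁ r₂ i₁ j₁ i₂ j₂ x v) ×
    (∀ y → GluedAcross r₂ r₁ i₂ j₂ i₁ j₁ y u ⊎ GluedWithin r₂ r₁ i₂ j₂ i₁ j₁ y v)


swapSeparation : ∀ {G G₁ G₂ i₁ j₁ i₂ j₂} → TwoSeparation G G₁ G₂ i₁ j₁ i₂ j₂ → TwoSeparation G G₂ G₁ i₂ j₂ i₁ j₁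
swapSeparation sep = record
  { φ₁ = φ₂ ; φ₂ = φ₁ ; φ₁-inj = φ₂-inj ; φ₂-inj = φ₁-inj ; ψ₁ = ψ₂ ; ψ₂ = ψ₁ ; ψ₁-inj = ψ₂-inj ; ψ₂-inj = ψ₁-inj
  ; ψ₁-ends = ψ₂-ends ; ψ₂-ends = ψ₁-ends
  ; V-cover = swap ∘ V-cover ; E-cover = swap ∘ E-cover
  ; E-disj = λ a b eq → E-disj b a (sym eq)
  ; i-glue = sym i-glue ; j-glue = sym j-glue ; i≢j = i₂≢j₂ sep
  ; meet = λ a b eq → swapPairs (meet b a (sym eq)) }
  where
  open TwoSeparation sep
  swap : ∀ {A B : Set} → A ⊎ B → B ⊎ A
  swap = [ inj₂ , inj₁ ]′
  swapPairs : ∀ {A B C D : Set} → (A × B) ⊎ (C × D) → (B × A) ⊎ (D × C)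
  swapPairs (inj₁ (a , b)) = inj₁ (b , a)
  swapPairs (inj₂ (c , d)) = inj₂ (d , c)

record Traces {G G₁ G₂ i₁ j₁ i₂ j₂} (sep : TwoSeparation G G₁ G₂ i₁ j₁ i₂ j₂)
              (F : Subset (m G)) (S₁ : Subset (m G₁)) (S₂ : Subset (m G₂)) : Set where
  field
    to₁   : ∀ {a} → a ∈ S₁ → TwoSeparation.ψ₁ sep a ∈ F
    from₁ : ∀ {a} → TwoSeparation.ψ₁ sep a ∈ F → a ∈ S₁
    to₂   : ∀ {b} → b ∈ S₂ → TwoSeparation.ψ₂ sep b ∈ F
    from₂ : ∀ {b} → TwoSeparation.ψ₂ sep b ∈ F → b ∈ S₂

module _ {G G₁ G₂ i₁ j₁ i₂ j₂} (sep : TwoSeparation G G₁ G₂ i₁ j₁ i₂ j₂) where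
  open TwoSeparation sep

  restrictTraces : ∀ F → Traces sep F (restrict ψ₁ F) (restrict ψ₂ F)
  restrictTraces F = record { to₁ = restrict⁻ ; from₁ = restrict⁺ ; to₂ = restrict⁻ ; from₂ = restrict⁺ }

  swapTraces : ∀ {F S₁ S₂} → Traces sep F S₁ S₂ → Traces (swapSeparation sep) F S₂ S₁
  swapTraces t = record { to₁ = to₂ ; from₁ = from₂ ; to₂ = to₁ ; from₂ = from₁ }
    where open Traces t

  deleteTraces : ∀ {F S₁ S₂} → Traces sep F S₁ S₂ → ∀ e → Traces sep (F ─ ψ₁ e) (S₁ ─ e) S₂
  deleteTraces t e = record
    { to₁ = λ q → let (a∈ , a≢e) = ∈─⁻ q in ∈─⁺ (to₁ a∈) (a≢e ∘ ψ₁-inj)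
    ; from₁ = λ q → let (ψa∈ , ψa≢ψe) = ∈─⁻ q in ∈─⁺ (from₁ ψa∈) (ψa≢ψe ∘ cong ψ₁)
    ; to₂ = λ {b} q → ∈─⁺ (to₂ q) (λ eq → E-disj e b (sym eq))
    ; from₂ = λ q → from₂ (proj₁ (∈─⁻ q)) }
    where open Traces t

module Gluing {G G₁ G₂ i₁ j₁ i₂ j₂} (sep : TwoSeparation G G₁ G₂ i₁ j₁ i₂ j₂)
              {F S₁ S₂} (traces : Traces sep F S₁ S₂) where

  open TwoSeparation sep
  open Traces traces

  Within : V G₁ → V G₁ → Set
  Within = GluedWithin (Reach G₁ S₁) (Reach G₂ S₂) i₁ j₁ i₂ j₂

  Across : V G₁ → V G₂ → Set
  Across = GluedAcross (Reach G₁ S₁) (Reach G₂ S₂) i₁ j₁ i₂ j₂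

  lift₁ : ∀ {x y} → Reach G₁ S₁ x y → Reach G F (φ₁ x) (φ₁ y)
  lift₁ = mapReach G₁ G φ₁ (λ e p → ψ₁ e , to₁ p , ψ₁-ends e)

  lift₂ : ∀ {x y} → Reach G₂ S₂ x y → Reach G F (φ₂ x) (φ₂ y)
  lift₂ = mapReach G₂ G φ₂ (λ e p → ψ₂ e , to₂ p , ψ₂-ends e)

  private
    _⨾_ : ∀ {x y z} → Reach G F x y → Reach G F y z → Reach G F x z
    _⨾_ = Reach-trans G
    infixr 5 _⨾_

  Within-sound : ∀ {x y} → Within x y → Reach G F (φ₁ x) (φ₁ y)
  Within-sound (inj₁ r) = lift₁ r
  Within-sound (inj₂ (inj₁ (xi , jy , ij))) = lift₁ xi ⨾ subst₂ (Reach G F) (sym i-glue) (sym j-glue) (lift₂ ij) ⨾ lift₁ jy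
  Within-sound (inj₂ (inj₂ (xj , iy , ij))) =
    lift₁ xj ⨾ subst₂ (Reach G F) (sym j-glue) (sym i-glue) (Reach-sym G (lift₂ ij)) ⨾ lift₁ iy

  Across-sound : ∀ {x y} → Across x y → Reach G F (φ₁ x) (φ₂ y)
  Across-sound (inj₁ (xi , iy)) = lift₁ xi ⨾ subst (λ z → Reach G F z _) (sym i-glue) (lift₂ iy)
  Across-sound (inj₂ (xj , jy)) = lift₁ xj ⨾ subst (λ z → Reach G F z _) (sym j-glue) (lift₂ jy)

  -- For completeness we follow a walk of G from φ₁ x and maintain the
  -- invariant that every preimage of the current vertex is glued-related to x.
  private
    Invariant : V G₁ → V G → Set
    Invariant x z = (∀ a → φ₁ a ≡ z → Within x a) × (∀ b → φ₂ b ≡ z → Across x b)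

    Within-extend : ∀ {x a b} → Within x a → Reach G₁ S₁ a b → Within x b
    Within-extend (inj₁ r) q = inj₁ (Reach-trans G₁ r q)
    Within-extend (inj₂ (inj₁ (xi , ja , ij))) q = inj₂ (inj₁ (xi , Reach-trans G₁ ja q , ij))
    Within-extend (inj₂ (inj₂ (xj , ia , ij))) q = inj₂ (inj₂ (xj , Reach-trans G₁ ia q , ij))

    Across-extend : ∀ {x a b} → Across x a → Reach G₂ S₂ a b → Across x b
    Across-extend (inj₁ (xi , ia)) q = inj₁ (xi , Reach-trans G₂ ia q)
    Across-extend (inj₂ (xj , ja)) q = inj₂ (xj , Reach-trans G₂ ja q)

    cross : ∀ {x a b} → φ₁ a ≡ φ₂ b → Within x a → Across x b
    cross {x} eq w with meet _ _ eq
    ... | inj₁ (refl , refl) = atI w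
      where
      atI : Within x i₁ → Across x i₂
      atI (inj₁ xi) = inj₁ (xi , here)
      atI (inj₂ (inj₁ (xi , _ , _))) = inj₁ (xi , here)
      atI (inj₂ (inj₂ (xj , _ , ij))) = inj₂ (xj , Reach-sym G₂ ij)
    ... | inj₂ (refl , refl) = atJ w
      where
      atJ : Within x j₁ → Across x j₂
      atJ (inj₁ xj) = inj₂ (xj , here)
      atJ (inj₂ (inj₁ (xi , _ , ij))) = inj₁ (xi , ij)
      atJ (inj₂ (inj₂ (xj , _ , _))) = inj₂ (xj , here)

    uncross : ∀ {x a b} → φ₁ a ≡ φ₂ b → Across x b → Within x a
    uncross {x} eq c with meet _ _ eq
    ... | inj₁ (refl , refl) = atI c
      where
      atI : Across x i₂ → Within x i₁
      atI (inj₁ (xi , _)) = inj₁ xi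
      atI (inj₂ (xj , ji)) = inj₂ (inj₂ (xj , here , Reach-sym G₂ ji))
    ... | inj₂ (refl , refl) = atJ c
      where
      atJ : Across x j₂ → Within x j₁
      atJ (inj₁ (xi , ij)) = inj₂ (inj₁ (xi , here , ij))
      atJ (inj₂ (xj , _)) = inj₁ xj

    invariant-start : ∀ x → Invariant x (φ₁ x)
    invariant-start x = (λ a eq → subst (Within x) (φ₁-inj (sym eq)) (inj₁ here)) ,
                        (λ b eq → cross (sym eq) (inj₁ here))

    invariant-step : ∀ {x z z′ f} → Invariant x z → f ∈ F → Joins G f z z′ → Invariant x z′
    invariant-step {x} {z} {z′} {f} (inv₁ , inv₂) f∈F joins with E-cover f
    ... | inj₁ (e , refl) = [ (λ (s , t) → along (Joins-ends G₁ e) s t) , (λ (s , t) → along (Joins-sym G₁ (Joins-ends G₁ e)) s t) ]′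
                              (Joins-unique G joins (ψ₁-ends e))
      where
      along : ∀ {a₀ a₁} → Joins G₁ e a₀ a₁ → z ≡ φ₁ a₀ → z′ ≡ φ₁ a₁ → Invariant x z′
      along je z≡ z′≡ =
        let w = Within-extend (inv₁ _ (sym z≡)) (Reach-edge G₁ (from₁ f∈F) je) in
        (λ a eq → subst (Within x) (φ₁-inj (trans (sym z′≡) (sym eq))) w) ,
        (λ b eq → cross (trans (sym z′≡) (sym eq)) w)
    ... | inj₂ (e , refl) = [ (λ (s , t) → along (Joins-ends G₂ e) s t) , (λ (s , t) → along (Joins-sym G₂ (Joins-ends G₂ e)) s t) ]′
                              (Joins-unique G joins (ψ₂-ends e))
      where
      along : ∀ {b₀ b₁} → Joins G₂ e b₀ b₁ → z ≡ φ₂ b₀ → z′ ≡ φ₂ b₁ → Invariant x z′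
      along je z≡ z′≡ =
        let c = Across-extend (inv₂ _ (sym z≡)) (Reach-edge G₂ (from₂ f∈F) je) in
        (λ a eq → uncross (trans eq z′≡) c) ,
        (λ b eq → subst (Across x) (φ₂-inj (trans (sym z′≡) (sym eq))) c)

    invariant-walk : ∀ {x z z′} → Reach G F z z′ → Invariant x z → Invariant x z′
    invariant-walk here inv = inv
    invariant-walk (step f p j r) inv = invariant-walk r (invariant-step inv p j)

  Within-complete : ∀ {x y} → Reach G F (φ₁ x) (φ₁ y) → Within x y
  Within-complete {x} {y} r = proj₁ (invariant-walk r (invariant-start x)) y refl

  Across-complete : ∀ {x y} → Reach G F (φ₁ x) (φ₂ y) → Across x y
  Across-complete {x} {y} r = proj₂ (invariant-walk r (invariant-start x)) y refl

-- Acyclicity of F in terms of its traces: F is acyclic iff both traces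
-- are, and they do not both connect i and j (which would close a cycle
-- through the two pieces).
module GluingOneSide {G G₁ G₂ i₁ j₁ i₂ j₂} (sep : TwoSeparation G G₁ G₂ i₁ j₁ i₂ j₂)
                     {F S₁ S₂} (traces : Traces sep F S₁ S₂) where

  open TwoSeparation sep
  open Traces traces
  module Deleted (e : E G₁) = Gluing sep (deleteTraces sep traces e)

  piece-acyclic : Acyclic G F → Acyclic G₁ S₁
  piece-acyclic acyclic c = acyclic (mapCycle G₁ G φ₁ ψ₁ φ₁-inj ψ₁-inj ψ₁-ends (λ _ → to₁) c)

  not-both-linked : Acyclic G F → ¬ (Reach G₁ S₁ i₁ j₁ × Reach G₂ S₂ i₂ j₂)
  not-both-linked acyclic (ij₁ , ij₂) =
    let (e , w , e∈S₁ , joins , wj) = firstEdge G₁ ij₁ i≢j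
        back : Reach G (F ─ ψ₁ e) (φ₁ w) (φ₁ i₁)
        back = Reach-trans G (Deleted.lift₁ e wj)
                 (subst₂ (Reach G _) (sym j-glue) (sym i-glue) (Deleted.lift₂ e (Reach-sym G₂ ij₂)))
    in Acyclic⇒Bridges G acyclic (ψ₁ e) (to₁ e∈S₁) (mapJoins G₁ G φ₁ (ψ₁-ends e) joins) (Reach-sym G back)

  piece-bridges : Acyclic G₁ S₁ → ¬ (Reach G₁ S₁ i₁ j₁ × Reach G₂ S₂ i₂ j₂) →
                  ∀ e → e ∈ S₁ → ∀ {x y} → Joins G (ψ₁ e) x y → ¬ Reach G (F ─ ψ₁ e) x y
  piece-bridges acyclic₁ ¬both e e∈S₁ joins =
    bridge-ends G {S = F} (ψ₁-ends e) joins (λ r → excluded (Deleted.Within-complete e r))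
    where
    shrink : ∀ {x y} → Reach G₁ (S₁ ─ e) x y → Reach G₁ S₁ x y
    shrink = Reach-mono G₁ (λ _ → proj₁ ∘ ∈─⁻)
    across-e : Reach G₁ S₁ (src G₁ e) (tgt G₁ e)
    across-e = Reach-edge G₁ e∈S₁ (Joins-ends G₁ e)
    excluded : Deleted.Within e (src G₁ e) (tgt G₁ e) → ⊥
    excluded (inj₁ r) = Acyclic⇒Bridges G₁ acyclic₁ e e∈S₁ (Joins-ends G₁ e) r
    excluded (inj₂ (inj₁ (si , jt , ij₂))) =
      ¬both (Reach-trans G₁ (Reach-sym G₁ (shrink si)) (Reach-trans G₁ across-e (Reach-sym G₁ (shrink jt))) , ij₂)
    excluded (inj₂ (inj₂ (sj , it , ij₂))) =
      ¬both (Reach-sym G₁ (Reach-trans G₁ (Reach-sym G₁ (shrink sj)) (Reach-trans G₁ across-e (Reach-sym G₁ (shrink it)))) , ij₂)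

module _ {G G₁ G₂ i₁ j₁ i₂ j₂} (sep : TwoSeparation G G₁ G₂ i₁ j₁ i₂ j₂)
         {F S₁ S₂} (traces : Traces sep F S₁ S₂) where

  open TwoSeparation sep
  private
    module One = GluingOneSide sep traces
    module Two = GluingOneSide (swapSeparation sep) (swapTraces sep traces)

  glued-acyclic⇒ : Acyclic G F → Acyclic G₁ S₁ × Acyclic G₂ S₂ × ¬ (Reach G₁ S₁ i₁ j₁ × Reach G₂ S₂ i₂ j₂)
  glued-acyclic⇒ acyclic = One.piece-acyclic acyclic , Two.piece-acyclic acyclic , One.not-both-linked acyclic

  glued-acyclic⇐ : Acyclic G₁ S₁ → Acyclic G₂ S₂ → ¬ (Reach G₁ S₁ i₁ j₁ × Reach G₂ S₂ i₂ j₂) → Acyclic G F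
  glued-acyclic⇐ acyclic₁ acyclic₂ ¬both = Bridges⇒Acyclic G bridges
    where
    open Traces traces
    bridges : Bridges G F
    bridges f f∈F with E-cover f
    ... | inj₁ (e , refl) = One.piece-bridges acyclic₁ ¬both e (from₁ f∈F)
    ... | inj₂ (e , refl) = Two.piece-bridges acyclic₂ (λ (ij₂ , ij₁) → ¬both (ij₁ , ij₂)) e (from₂ f∈F)

  private
    module Glue₁ = Gluing sep traces
    module Glue₂ = Gluing (swapSeparation sep) (swapTraces sep traces)

  TracesTwoForest : V G₁ → V G₂ → Set
  TracesTwoForest = GluedTwoForest (Reach G₁ S₁) (Reach G₂ S₂) i₁ j₁ i₂ j₂ (Acyclic G₁ S₁) (Acyclic G₂ S₂)

  twoForest⇒traces : ∀ u v → TwoForest G (φ₁ u) (φ₂ v) F → TracesTwoForest u v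
  twoForest⇒traces u v (acyclic , ¬uv , cover) =
    let (acyclic₁ , acyclic₂ , ¬both) = glued-acyclic⇒ acyclic in
    acyclic₁ , acyclic₂ , ¬both , ¬uv ∘ Glue₁.Across-sound ,
    (λ x → ⊎-map Glue₁.Within-complete Glue₁.Across-complete (cover (φ₁ x))) ,
    (λ y → ⊎-map Glue₂.Across-complete Glue₂.Within-complete (cover (φ₂ y)))

  traces⇒twoForest : ∀ u v → TracesTwoForest u v → TwoForest G (φ₁ u) (φ₂ v) F
  traces⇒twoForest u v (acyclic₁ , acyclic₂ , ¬both , ¬uv , cover₁ , cover₂) =
    glued-acyclic⇐ acyclic₁ acyclic₂ ¬both , ¬uv ∘ Glue₁.Across-complete , cover
    where
    cover : ∀ z → Reach G F z (φ₁ u) ⊎ Reach G F z (φ₂ v)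
    cover z with V-cover z
    ... | inj₁ (x , refl) = ⊎-map Glue₁.Within-sound Glue₁.Across-sound (cover₁ x)
    ... | inj₂ (y , refl) = ⊎-map Glue₂.Across-sound Glue₂.Within-sound (cover₂ y)

-- Contraction.  The edges of H/ij are the edges of H not joining i and j,
-- in order; `FilterMap.index` recovers the position of an entry of
-- `map g (filter P? xs)` in xs.

module FilterMap {A B : Set} {P : A → Set} (P? : Decidable P) (g : A → B) where

  index : ∀ xs → Fin (List.length (map g (filter P? xs))) → Fin (List.length xs)
  index (x ∷ xs) a with P? x
  index (x ∷ xs) zero    | yes _ = zero
  index (x ∷ xs) (suc a) | yes _ = suc (index xs a)
  index (x ∷ xs) a       | no _  = suc (index xs a)

  index-lookup : ∀ xs a → List.lookup (map g (filter P? xs)) a ≡ g (List.lookup xs (index xs a))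
  index-lookup (x ∷ xs) a with P? x
  index-lookup (x ∷ xs) zero    | yes _ = refl
  index-lookup (x ∷ xs) (suc a) | yes _ = index-lookup xs a
  index-lookup (x ∷ xs) a       | no _  = index-lookup xs a

  index-satisfies : ∀ xs a → P (List.lookup xs (index xs a))
  index-satisfies (x ∷ xs) a with P? x
  index-satisfies (x ∷ xs) zero    | yes px = px
  index-satisfies (x ∷ xs) (suc a) | yes _  = index-satisfies xs a
  index-satisfies (x ∷ xs) a       | no _   = index-satisfies xs a

  index-injective : ∀ xs {a b} → index xs a ≡ index xs b → a ≡ b
  index-injective (x ∷ xs) {a} {b} eq with P? x
  index-injective (x ∷ xs) {zero}  {zero}  eq | yes _ = refl
  index-injective (x ∷ xs) {suc a} {suc b} eq | yes _ = cong suc (index-injective xs (suc-injective eq))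
  index-injective (x ∷ xs) {a}     {b}     eq | no _  = index-injective xs (suc-injective eq)

  index-surjective : ∀ xs e → P (List.lookup xs e) → Σ _ λ a → index xs a ≡ e
  index-surjective (x ∷ xs) e q with P? x
  index-surjective (x ∷ xs) zero    q | yes _ = zero , refl
  index-surjective (x ∷ xs) (suc e) q | yes _ = let (a , eq) = index-surjective xs e q in suc a , cong suc eq
  index-surjective (x ∷ xs) zero    q | no ¬q = ⊥-elim (¬q q)
  index-surjective (x ∷ xs) (suc e) q | no _  = let (a , eq) = index-surjective xs e q in a , cong suc eq

module Merge {k : ℕ} (i j : Fin (suc k)) (i≢j : i ≢ j) where

  π : Fin (suc k) → Fin k
  π = merge i j i≢j

  π-fibres : ∀ {x y} → π x ≡ π y → x ≡ y ⊎ (x ≡ i × y ≡ j) ⊎ (x ≡ j × y ≡ i)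
  π-fibres {x} {y} eq with x Fin.≟ j | y Fin.≟ j
  ... | yes x≡j | yes y≡j = inj₁ (trans x≡j (sym y≡j))
  ... | yes x≡j | no y≢j  = inj₂ (inj₂ (x≡j , sym (punchOut-injective (i≢j ∘ sym) (y≢j ∘ sym) eq)))
  ... | no x≢j  | yes y≡j = inj₂ (inj₁ (punchOut-injective (x≢j ∘ sym) (i≢j ∘ sym) eq , y≡j))
  ... | no x≢j  | no y≢j  = inj₁ (punchOut-injective (x≢j ∘ sym) (y≢j ∘ sym) eq)

  π-glues : π i ≡ π j
  π-glues with i Fin.≟ j | j Fin.≟ j
  ... | yes i≡j | _ = ⊥-elim (i≢j i≡j)
  ... | no _ | yes _ = punchOut-cong j refl
  ... | no _ | no j≢j = ⊥-elim (j≢j refl)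

  π-surjective : ∀ z → Σ (Fin (suc k)) λ x → π x ≡ z
  π-surjective z = punchIn j z , lemma
    where
    lemma : π (punchIn j z) ≡ z
    lemma with punchIn j z Fin.≟ j
    ... | yes eq = ⊥-elim (punchInᵢ≢i j z eq)
    ... | no _ = trans (punchOut-cong j refl) (punchOut-punchIn j)

-- the edge filter used by `contract` (which Defs keeps private)
avoidsPair? : ∀ {k} (i j : Fin k) (e : Fin k × Fin k) →
              Dec (¬ ((proj₁ e ≡ i × proj₂ e ≡ j) ⊎ (proj₁ e ≡ j × proj₂ e ≡ i)))
avoidsPair? i j e = ¬? (((proj₁ e Fin.≟ i) ×-dec (proj₂ e Fin.≟ j)) ⊎-dec ((proj₁ e Fin.≟ j) ×-dec (proj₂ e Fin.≟ i)))

module Contraction (k : ℕ) (es : List (Fin (suc k) × Fin (suc k))) (i j : Fin (suc k)) (i≢j : i ≢ j) where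

  H : Graph
  H = mkGraph (suc k) es

  K : Graph
  K = contract H i j i≢j

  open Merge i j i≢j public
  private
    module Index = FilterMap (avoidsPair? i j) (λ e → π (proj₁ e) , π (proj₂ e))

  ι : E K → E H
  ι = Index.index es

  ι-ends : ∀ a → Joins K a (π (src H (ι a))) (π (tgt H (ι a)))
  ι-ends a = inj₁ (cong proj₁ (Index.index-lookup es a) , cong proj₂ (Index.index-lookup es a))

  -- S avoids the edges between i and j, which disappear in H/ij
  AvoidsIJ : Subset (m H) → Set
  AvoidsIJ S = ∀ e → e ∈ S → ¬ Joins H e i j

  record Lifts (S′ : Subset (m K)) (S : Subset (m H)) : Set where
    field
      to     : ∀ {a} → a ∈ S′ → ι a ∈ S
      from   : ∀ {a} → ι a ∈ S → a ∈ S′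
      avoids : AvoidsIJ S

  preimage : ∀ {S′ S} → Lifts S′ S → ∀ {e} → e ∈ S → Σ (E K) λ a → ι a ≡ e × a ∈ S′
  preimage lifts {e} e∈S with Index.index-surjective es e (Lifts.avoids lifts e e∈S)
  ... | a , refl = a , refl , Lifts.from lifts e∈S

  deleteLifts : ∀ {S′ S} → Lifts S′ S → ∀ a → Lifts (S′ ─ a) (S ─ ι a)
  deleteLifts lifts a = record
    { to = λ q → let (b∈ , b≢a) = ∈─⁻ q in ∈─⁺ (to b∈) (b≢a ∘ Index.index-injective es)
    ; from = λ q → let (ιb∈ , ιb≢ιa) = ∈─⁻ q in ∈─⁺ (from ιb∈) (ιb≢ιa ∘ cong ι)
    ; avoids = λ e q → avoids e (proj₁ (∈─⁻ q)) }
    where open Lifts lifts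

  module ContractedReach {S′ S} (lifts : Lifts S′ S) where

    Modulo : V H → V H → Set
    Modulo = ReachModulo (Reach H S) i j

    project : ∀ {x y} → Reach H S x y → Reach K S′ (π x) (π y)
    project = mapReach H K π image
      where
      image : ∀ e → e ∈ S → Σ (E K) λ a → a ∈ S′ × Joins K a (π (src H e)) (π (tgt H e))
      image e e∈S with preimage lifts e∈S
      ... | a , refl , a∈S′ = a , a∈S′ , ι-ends a

    Modulo-sound : ∀ {x y} → Modulo x y → Reach K S′ (π x) (π y)
    Modulo-sound (inj₁ r) = project r
    Modulo-sound {y = y} (inj₂ (inj₁ (xi , jy))) =
      Reach-trans K (project xi) (subst (λ z → Reach K S′ z (π y)) (sym π-glues) (project jy))
    Modulo-sound {y = y} (inj₂ (inj₂ (xj , iy))) =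
      Reach-trans K (project xj) (subst (λ z → Reach K S′ z (π y)) π-glues (project iy))

    -- completeness: along a walk of H/ij from π x, every preimage of the
    -- current vertex stays related to x modulo i = j
    private
      Invariant : V H → V K → Set
      Invariant x z = ∀ a → π a ≡ z → Modulo x a

      Modulo-fibre : ∀ {x a b} → π a ≡ π b → Modulo x a → Modulo x b
      Modulo-fibre {x} {a} {b} eq w with π-fibres {a} {b} eq
      ... | inj₁ refl = w
      ... | inj₂ (inj₁ (refl , refl)) = toJ w
        where
        toJ : Modulo x i → Modulo x j
        toJ (inj₁ xi) = inj₂ (inj₁ (xi , here))
        toJ (inj₂ (inj₁ (xi , _))) = inj₂ (inj₁ (xi , here))
        toJ (inj₂ (inj₂ (xj , _))) = inj₁ xj
      ... | inj₂ (inj₂ (refl , refl)) = toI w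
        where
        toI : Modulo x j → Modulo x i
        toI (inj₁ xj) = inj₂ (inj₂ (xj , here))
        toI (inj₂ (inj₁ (xi , _))) = inj₁ xi
        toI (inj₂ (inj₂ (xj , _))) = inj₂ (inj₂ (xj , here))

      Modulo-extend : ∀ {x a b} → Modulo x a → Reach H S a b → Modulo x b
      Modulo-extend (inj₁ r) q = inj₁ (Reach-trans H r q)
      Modulo-extend (inj₂ (inj₁ (xi , ja))) q = inj₂ (inj₁ (xi , Reach-trans H ja q))
      Modulo-extend (inj₂ (inj₂ (xj , ia))) q = inj₂ (inj₂ (xj , Reach-trans H ia q))

      invariant-step : ∀ {x z z′ a} → Invariant x z → a ∈ S′ → Joins K a z z′ → Invariant x z′
      invariant-step {x} {z} {z′} {a} inv a∈S′ joins =
        [ (λ (s , t) → along (Joins-ends H (ι a)) s t) , (λ (s , t) → along (Joins-sym H (Joins-ends H (ι a))) s t) ]′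
          (Joins-unique K joins (ι-ends a))
        where
        along : ∀ {b₀ b₁} → Joins H (ι a) b₀ b₁ → z ≡ π b₀ → z′ ≡ π b₁ → Invariant x z′
        along jb z≡ z′≡ b eq =
          Modulo-fibre (trans (sym z′≡) (sym eq)) (Modulo-extend (inv _ (sym z≡)) (Reach-edge H (Lifts.to lifts a∈S′) jb))

      invariant-walk : ∀ {x z z′} → Reach K S′ z z′ → Invariant x z → Invariant x z′
      invariant-walk here inv = inv
      invariant-walk (step a p j r) inv = invariant-walk r (invariant-step inv p j)

    Modulo-complete : ∀ {x y} → Reach K S′ (π x) (π y) → Modulo x y
    Modulo-complete {x} {y} r = invariant-walk r (λ a eq → Modulo-fibre (sym eq) (inj₁ here)) y refl

  module _ {S′ S} (lifts : Lifts S′ S) where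
    open Lifts lifts
    private
      module Deleted (a : E K) = ContractedReach (deleteLifts lifts a)

    contracted-acyclic⇒ : Acyclic K S′ → Acyclic H S × ¬ Reach H S i j
    contracted-acyclic⇒ acyclic = Bridges⇒Acyclic H bridges , ¬ij
      where
      bridgesK : Bridges K S′
      bridgesK = Acyclic⇒Bridges K acyclic
      bridges : Bridges H S
      bridges e e∈S joins q with preimage lifts e∈S
      ... | a , refl , a∈S′ = bridgesK a a∈S′ (mapJoins H K π (ι-ends a) joins) (Deleted.project a q)
      ¬ij : ¬ Reach H S i j
      ¬ij ij with firstEdge H ij i≢j
      ... | e , w , e∈S , joins , wj with preimage lifts e∈S
      ... | a , refl , a∈S′ = bridgesK a a∈S′ (mapJoins H K π (ι-ends a) joins)
              (Reach-sym K (subst (Reach K _ _) (sym π-glues) (Deleted.project a wj)))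

    contracted-acyclic⇐ : Acyclic H S → ¬ Reach H S i j → Acyclic K S′
    contracted-acyclic⇐ acyclic ¬ij = Bridges⇒Acyclic K bridges
      where
      bridges : Bridges K S′
      bridges a a∈S′ joins = bridge-ends K {S = S′} (ι-ends a) joins (λ r → excluded (Deleted.Modulo-complete a r))
        where
        e : E H
        e = ι a
        shrink : ∀ {x y} → Reach H (S ─ e) x y → Reach H S x y
        shrink = Reach-mono H (λ _ → proj₁ ∘ ∈─⁻)
        across-e : Reach H S (src H e) (tgt H e)
        across-e = Reach-edge H (to a∈S′) (Joins-ends H e)
        excluded : Deleted.Modulo a (src H e) (tgt H e) → ⊥
        excluded (inj₁ r) = Acyclic⇒Bridges H acyclic e (to a∈S′) (Joins-ends H e) r
        excluded (inj₂ (inj₁ (si , jt))) =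
          ¬ij (Reach-trans H (Reach-sym H (shrink si)) (Reach-trans H across-e (Reach-sym H (shrink jt))))
        excluded (inj₂ (inj₂ (sj , it))) =
          ¬ij (Reach-sym H (Reach-trans H (Reach-sym H (shrink sj)) (Reach-trans H across-e (Reach-sym H (shrink it)))))

    twoForest⇒contracted : ∀ u → TwoForest K (π u) (π i) S′ → ContractedTwoForest (Reach H S) (Acyclic H S) u i j
    twoForest⇒contracted u (acyclic , ¬ui , cover) =
      let (acyclicH , ¬ij) = contracted-acyclic⇒ acyclic in
      acyclicH , ¬ij , ¬ui ∘ Modulo-sound , λ x → ⊎-map Modulo-complete Modulo-complete (cover (π x))
      where open ContractedReach lifts

    contracted⇒twoForest : ∀ u → ContractedTwoForest (Reach H S) (Acyclic H S) u i j → TwoForest K (π u) (π i) S′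
    contracted⇒twoForest u (acyclic , ¬ij , ¬ui , cover) =
      contracted-acyclic⇐ acyclic ¬ij , ¬ui ∘ Modulo-complete , cover′
      where
      open ContractedReach lifts
      cover′ : ∀ z → Reach K S′ z (π u) ⊎ Reach K S′ z (π i)
      cover′ z with π-surjective z
      ... | x , refl = ⊎-map Modulo-sound Modulo-sound (cover x)

  -- Subsets of E(H/ij) are the subsets of E(H) avoiding the i–j edges:
  -- `pull` restricts along ι and `push` extends by false.
  pull : Subset (m H) → Subset (m K)
  pull = restrict ι

  pushAt : Subset (m K) → E H → Bool
  pushAt S′ e with any? (λ a → ι a Fin.≟ e)
  ... | yes (a , _) = lookup S′ a
  ... | no _ = false

  push : Subset (m K) → Subset (m H)
  push S′ = tabulate (pushAt S′)

  pull-push : ∀ S′ → pull (push S′) ≡ S′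
  pull-push S′ = trans (tabulate-cong at) (tabulate∘lookup S′)
    where
    at : ∀ a → lookup (push S′) (ι a) ≡ lookup S′ a
    at a rewrite lookup∘tabulate (pushAt S′) (ι a) with any? (λ a′ → ι a′ Fin.≟ ι a)
    ... | yes (a′ , eq) = cong (lookup S′) (Index.index-injective es eq)
    ... | no ∄a′ = ⊥-elim (∄a′ (a , refl))

  push-pull : ∀ S → AvoidsIJ S → push (pull S) ≡ S
  push-pull S avoids = trans (tabulate-cong at) (tabulate∘lookup S)
    where
    at : ∀ e → pushAt (pull S) e ≡ lookup S e
    at e with any? (λ a → ι a Fin.≟ e)
    ... | yes (a , refl) = lookup∘tabulate (λ a → lookup S (ι a)) a
    ... | no ∄a with lookup S e in eq
    ...   | false = refl
    ...   | true = ⊥-elim (∄a (Index.index-surjective es e (avoids e (lookup⇒∈ eq))))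

  push-avoids : ∀ S′ → AvoidsIJ (push S′)
  push-avoids S′ e e∈ = pushed (trans (sym (lookup∘tabulate (pushAt S′) e)) ([]=⇒lookup e∈))
    where
    pushed : pushAt S′ e ≡ true → ¬ Joins H e i j
    pushed eq with any? (λ a → ι a Fin.≟ e)
    pushed eq | yes (a , refl) = Index.index-satisfies es a
    pushed () | no _

  pullLifts : ∀ S → AvoidsIJ S → Lifts (pull S) S
  pullLifts S avoids = record { to = restrict⁻ ; from = restrict⁺ ; avoids = avoids }

  contractedCounts : ∀ u {f} → NumTwoForests K (π u) (π i) f →
                     Counts (λ S → ContractedTwoForest (Reach H S) (Acyclic H S) u i j) f
  contractedCounts u C = Counts-⇔
    (λ S (avoids , tf) → twoForest⇒contracted (pullLifts S avoids) u tf)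
    (λ S cf → avoidsOf cf , contracted⇒twoForest (pullLifts S (avoidsOf cf)) u cf)
    (Counts-embed pull push AvoidsIJ pull-push push-pull push-avoids C)
    where
    avoidsOf : ∀ {S} → ContractedTwoForest (Reach H S) (Acyclic H S) u i j → AvoidsIJ S
    avoidsOf (_ , ¬ij , _) e e∈S joins = ¬ij (Reach-edge H e∈S joins)

contractionCounts : ∀ (H : Graph) (i j : V H) (i≢j : i ≢ j) u {f} →
  NumTwoForests (contract H i j i≢j) (contractV H i j i≢j u) (contractV H i j i≢j i) f →
  Counts (λ S → ContractedTwoForest (Reach H S) (Acyclic H S) u i j) f
contractionCounts (mkGraph zero es) () j i≢j u C
contractionCounts (mkGraph (suc k) es) i j i≢j u C = Contraction.contractedCounts k es i j i≢j u C

Reach-isEquivalence : ∀ G S → IsEquivalence (Reach G S)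
Reach-isEquivalence G S = record { refl = here ; sym = Reach-sym G ; trans = Reach-trans G }

-- Spanning forests of one piece with marked vertices u, i, j, abstractly:
-- r is the connectivity (an equivalence) and A stands for acyclicity.
-- Two-forests in which i and j are connected (u apart), or separated with
-- u joined to i or to j, form three classes; each of 𝓕(u,i), 𝓕(u,j),
-- 𝓕(i,j) is the sum of two of them.
module SideClasses {W : Set} {r : W → W → Set} (r-equiv : IsEquivalence r) (r? : ∀ x y → Dec (r x y))
                   (A : Set) (u i j : W) where

  open IsEquivalence r-equiv renaming (refl to r-refl; sym to r-sym; trans to r-trans)

  Tree : Set
  Tree = A × (∀ x y → r x y)

  TwoForestOf : W → W → Set
  TwoForestOf p q = A × ¬ r p q × (∀ x → r x p ⊎ r x q)

  Contracted : Set
  Contracted = ContractedTwoForest r A u i j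

  UApart : Set
  UApart = TwoForestOf u i × r i j

  UWithI : Set
  UWithI = TwoForestOf i j × r u i

  UWithJ : Set
  UWithJ = TwoForestOf i j × r u j

  separates-ui⇒ : TwoForestOf u i → UApart ⊎ UWithJ
  separates-ui⇒ tf@(acyclic , ¬ui , cover) with r? i j
  ... | yes ij = inj₁ (tf , ij)
  ... | no ¬ij = inj₂ ((acyclic , ¬ij , λ x → [ (λ xu → inj₂ (r-trans xu uj)) , inj₁ ]′ (cover x)) , uj)
    where
    uj : r u j
    uj = [ r-sym , (λ ji → ⊥-elim (¬ij (r-sym ji))) ]′ (cover j)

  separates-ui⇐ : UApart ⊎ UWithJ → TwoForestOf u i
  separates-ui⇐ (inj₁ (tf , _)) = tf
  separates-ui⇐ (inj₂ ((acyclic , ¬ij , cover) , uj)) =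
    acyclic , (λ ui → ¬ij (r-trans (r-sym ui) uj)) , λ x → [ inj₂ , (λ xj → inj₁ (r-trans xj (r-sym uj))) ]′ (cover x)

  separates-uj⇒ : TwoForestOf u j → UApart ⊎ UWithI
  separates-uj⇒ (acyclic , ¬uj , cover) with r? i j
  ... | yes ij = inj₁ ((acyclic , (λ ui → ¬uj (r-trans ui ij)) , λ x → [ inj₁ , (λ xj → inj₂ (r-trans xj (r-sym ij))) ]′ (cover x)) , ij)
  ... | no ¬ij = inj₂ ((acyclic , ¬ij , λ x → [ (λ xu → inj₁ (r-trans xu ui)) , inj₂ ]′ (cover x)) , ui)
    where
    ui : r u i
    ui = [ r-sym , (λ ij → ⊥-elim (¬ij ij)) ]′ (cover i)

  separates-uj⇐ : UApart ⊎ UWithI → TwoForestOf u j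
  separates-uj⇐ (inj₁ ((acyclic , ¬ui , cover) , ij)) =
    acyclic , (λ uj → ¬ui (r-trans uj (r-sym ij))) , λ x → [ inj₁ , (λ xi → inj₂ (r-trans xi ij)) ]′ (cover x)
  separates-uj⇐ (inj₂ ((acyclic , ¬ij , cover) , ui)) =
    acyclic , (λ uj → ¬ij (r-trans (r-sym ui) uj)) , λ x → [ (λ xi → inj₁ (r-trans xi (r-sym ui))) , inj₂ ]′ (cover x)

  separates-ij⇒ : TwoForestOf i j → UWithI ⊎ UWithJ
  separates-ij⇒ tf@(_ , _ , cover) with r? u i
  ... | yes ui = inj₁ (tf , ui)
  ... | no ¬ui = inj₂ (tf , [ (λ ui → ⊥-elim (¬ui ui)) , (λ uj → uj) ]′ (cover u))

  separates-ij⇐ : UWithI ⊎ UWithJ → TwoForestOf i j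
  separates-ij⇐ = [ proj₁ , proj₁ ]′

  apart-withI : UApart → UWithI → ⊥
  apart-withI ((_ , ¬ui , _) , _) (_ , ui) = ¬ui ui

  apart-withJ : UApart → UWithJ → ⊥
  apart-withJ ((_ , ¬ui , _) , ij) (_ , uj) = ¬ui (r-trans uj (r-sym ij))

  withI-withJ : UWithI → UWithJ → ⊥
  withI-withJ ((_ , ¬ij , _) , ui) (_ , uj) = ¬ij (r-trans (r-sym ui) uj)

  tree-contracted : Tree → Contracted → ⊥
  tree-contracted (_ , all) (_ , ¬ij , _) = ¬ij (all i j)

  tree-apart : Tree → UApart → ⊥
  tree-apart (_ , all) ((_ , ¬ui , _) , _) = ¬ui (all u i)

  tree-withI : Tree → UWithI → ⊥
  tree-withI (_ , all) ((_ , ¬ij , _) , _) = ¬ij (all i j)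

  tree-withJ : Tree → UWithJ → ⊥
  tree-withJ (_ , all) ((_ , ¬ij , _) , _) = ¬ij (all i j)

  contracted-apart : Contracted → UApart → ⊥
  contracted-apart (_ , ¬ij , _) (_ , ij) = ¬ij ij

  contracted-withI : Contracted → UWithI → ⊥
  contracted-withI (_ , _ , ¬ui , _) (_ , ui) = ¬ui (inj₁ ui)

  contracted-withJ : Contracted → UWithJ → ⊥
  contracted-withJ (_ , _ , ¬ui , _) (_ , uj) = ¬ui (inj₂ (inj₂ (uj , r-refl)))

module HalfDecomposition {V₁ V₂ : Set} {r₁ : V₁ → V₁ → Set} {r₂ : V₂ → V₂ → Set}
  (r₁-equiv : IsEquivalence r₁) (r₁? : ∀ x y → Dec (r₁ x y))
  (r₂-equiv : IsEquivalence r₂) (r₂? : ∀ x y → Dec (r₂ x y))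
  (A₁ A₂ : Set) (u i₁ j₁ : V₁) (v i₂ j₂ : V₂) where

  module S₁ = SideClasses r₁-equiv r₁? A₁ u i₁ j₁
  module S₂ = SideClasses r₂-equiv r₂? A₂ v i₂ j₂
  open IsEquivalence r₁-equiv renaming (refl to refl₁; sym to sym₁; trans to trans₁)
  open IsEquivalence r₂-equiv renaming (refl to refl₂; sym to sym₂; trans to trans₂)

  Glued : Set
  Glued = GluedTwoForest r₁ r₂ i₁ j₁ i₂ j₂ A₁ A₂ u v

  within₁-unlinked : ¬ r₂ i₂ j₂ → ∀ {x y} → GluedWithin r₁ r₂ i₁ j₁ i₂ j₂ x y → r₁ x y
  within₁-unlinked = GluedWithin-unlinked {r₁ = r₁} {r₂ = r₂} {i₁ = i₁} {j₁ = j₁} {i₂ = i₂} {j₂ = j₂}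

  within₂-unlinked : ¬ r₁ i₁ j₁ → ∀ {x y} → GluedWithin r₂ r₁ i₂ j₂ i₁ j₁ x y → r₂ x y
  within₂-unlinked = GluedWithin-unlinked {r₁ = r₂} {r₂ = r₁} {i₁ = i₂} {j₁ = j₂} {i₂ = i₁} {j₂ = j₁}

  linked₁-only : r₁ i₁ j₁ → ¬ r₂ i₂ j₂ → Glued → (S₁.Tree × S₂.Contracted) ⊎ (S₁.UApart × (S₂.UWithI ⊎ S₂.UWithJ))
  linked₁-only ij₁ ¬ij₂ (acyclic₁ , acyclic₂ , _ , ¬uv , cover₁ , cover₂) with r₁? u i₁
  ... | yes ui = inj₁ ((acyclic₁ , λ x y → trans₁ (toU x) (sym₁ (toU y))) , (acyclic₂ , ¬ij₂ , ¬vi , cover))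
    where
    toU : ∀ x → r₁ x u
    toU x = [ within₁-unlinked ¬ij₂
            , [ (λ (xi , _) → trans₁ xi (sym₁ ui)) , (λ (xj , _) → trans₁ xj (trans₁ (sym₁ ij₁) (sym₁ ui))) ]′ ]′ (cover₁ x)
    ¬vi : ¬ ReachModulo r₂ i₂ j₂ v i₂
    ¬vi (inj₁ vi) = ¬uv (inj₁ (ui , sym₂ vi))
    ¬vi (inj₂ (inj₁ (_ , ji))) = ¬ij₂ (sym₂ ji)
    ¬vi (inj₂ (inj₂ (vj , _))) = ¬uv (inj₂ (trans₁ ui ij₁ , sym₂ vj))
    cover : ∀ y → ReachModulo r₂ i₂ j₂ y v ⊎ ReachModulo r₂ i₂ j₂ y i₂
    cover y with cover₂ y
    ... | inj₁ (inj₁ (yi , _)) = inj₂ (inj₁ yi)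
    ... | inj₁ (inj₂ (yj , _)) = inj₂ (inj₂ (inj₂ (yj , refl₂)))
    ... | inj₂ (inj₁ yv) = inj₁ (inj₁ yv)
    ... | inj₂ (inj₂ (inj₁ (yi , _ , _))) = inj₂ (inj₁ yi)
    ... | inj₂ (inj₂ (inj₂ (yj , _ , _))) = inj₂ (inj₂ (inj₂ (yj , refl₂)))
  ... | no ¬ui = inj₂ (((acyclic₁ , ¬ui , cover) , ij₁) , [ (λ vi → inj₁ (forest₂ , vi)) , (λ vj → inj₂ (forest₂ , vj)) ]′ v∼ij)
    where
    cover : ∀ x → r₁ x u ⊎ r₁ x i₁
    cover x = [ inj₁ ∘ within₁-unlinked ¬ij₂ , inj₂ ∘ [ proj₁ , (λ (xj , _) → trans₁ xj (sym₁ ij₁)) ]′ ]′ (cover₁ x)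
    v∼ij : r₂ v i₂ ⊎ r₂ v j₂
    v∼ij = [ (λ w → ⊥-elim (¬ui (sym₁ (within₁-unlinked ¬ij₂ w))))
           , [ (λ (_ , iv) → inj₁ (sym₂ iv)) , (λ (_ , jv) → inj₂ (sym₂ jv)) ]′ ]′ (cover₁ i₁)
    cover′ : ∀ y → r₂ y i₂ ⊎ r₂ y j₂
    cover′ y with cover₂ y
    ... | inj₁ (inj₁ (yi , _)) = inj₁ yi
    ... | inj₁ (inj₂ (yj , _)) = inj₂ yj
    ... | inj₂ (inj₁ yv) = [ inj₁ ∘ trans₂ yv , inj₂ ∘ trans₂ yv ]′ v∼ij
    ... | inj₂ (inj₂ (inj₁ (yi , _ , _))) = inj₁ yi
    ... | inj₂ (inj₂ (inj₂ (yj , _ , _))) = inj₂ yj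
    forest₂ : S₂.TwoForestOf i₂ j₂
    forest₂ = acyclic₂ , ¬ij₂ , cover′

  unlinked-split : ¬ r₁ i₁ j₁ → ¬ r₂ i₂ j₂ → Glued → r₁ u i₁ ⊎ r₂ v i₂
  unlinked-split ¬ij₁ ¬ij₂ (_ , _ , _ , _ , cover₁ , _) =
    [ inj₁ ∘ sym₁ ∘ within₁-unlinked ¬ij₂ , [ (λ (_ , iv) → inj₂ (sym₂ iv)) , (λ (ij , _) → ⊥-elim (¬ij₁ ij)) ]′ ]′ (cover₁ i₁)

  unlinked-u∼i : ¬ r₁ i₁ j₁ → ¬ r₂ i₂ j₂ → Glued → r₁ u i₁ → S₁.UWithI × S₂.UWithJ
  unlinked-u∼i ¬ij₁ ¬ij₂ (acyclic₁ , acyclic₂ , _ , _ , cover₁ , cover₂) ui =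
    ((acyclic₁ , ¬ij₁ , cover) , ui) , ((acyclic₂ , ¬ij₂ , cover′) , vj)
    where
    vj : r₂ v j₂
    vj = [ (λ w → ⊥-elim (¬ij₁ (sym₁ (trans₁ (within₁-unlinked ¬ij₂ w) ui))))
         , [ (λ (ji , _) → ⊥-elim (¬ij₁ (sym₁ ji))) , (λ (_ , jv) → sym₂ jv) ]′ ]′ (cover₁ j₁)
    cover : ∀ x → r₁ x i₁ ⊎ r₁ x j₁
    cover x = [ (λ w → inj₁ (trans₁ (within₁-unlinked ¬ij₂ w) ui)) , [ inj₁ ∘ proj₁ , inj₂ ∘ proj₁ ]′ ]′ (cover₁ x)
    cover′ : ∀ y → r₂ y i₂ ⊎ r₂ y j₂
    cover′ y = [ [ inj₁ ∘ proj₁ , inj₂ ∘ proj₁ ]′ , (λ w → inj₂ (trans₂ (within₂-unlinked ¬ij₁ w) vj)) ]′ (cover₂ y)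

  tree-contracted⇒glued : S₁.Tree × S₂.Contracted → Glued
  tree-contracted⇒glued ((acyclic₁ , all₁) , (acyclic₂ , ¬ij₂ , ¬vi , cover)) =
    acyclic₁ , acyclic₂ , ¬ij₂ ∘ proj₂ , ¬uv , (λ x → inj₁ (inj₁ (all₁ x u))) , cover₂
    where
    ¬uv : ¬ GluedAcross r₁ r₂ i₁ j₁ i₂ j₂ u v
    ¬uv (inj₁ (_ , iv)) = ¬vi (inj₁ (sym₂ iv))
    ¬uv (inj₂ (_ , jv)) = ¬vi (inj₂ (inj₂ (sym₂ jv , refl₂)))
    cover₂ : ∀ y → GluedAcross r₂ r₁ i₂ j₂ i₁ j₁ y u ⊎ GluedWithin r₂ r₁ i₂ j₂ i₁ j₁ y v
    cover₂ y with cover y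
    ... | inj₁ (inj₁ yv) = inj₂ (inj₁ yv)
    ... | inj₁ (inj₂ (inj₁ (yi , jv))) = inj₂ (inj₂ (inj₁ (yi , jv , all₁ i₁ j₁)))
    ... | inj₁ (inj₂ (inj₂ (yj , iv))) = inj₂ (inj₂ (inj₂ (yj , iv , all₁ i₁ j₁)))
    ... | inj₂ (inj₁ yi) = inj₁ (inj₁ (yi , all₁ i₁ u))
    ... | inj₂ (inj₂ (inj₁ (yi , _))) = inj₁ (inj₁ (yi , all₁ i₁ u))
    ... | inj₂ (inj₂ (inj₂ (yj , _))) = inj₁ (inj₂ (yj , all₁ j₁ u))

  apart⇒glued : S₁.UApart × (S₂.UWithI ⊎ S₂.UWithJ) → Glued
  apart⇒glued (((acyclic₁ , ¬ui , cover) , ij₁) , inj₁ ((acyclic₂ , ¬ij₂ , cover′) , vi)) =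
    acyclic₁ , acyclic₂ , ¬ij₂ ∘ proj₂ , [ ¬ui ∘ proj₁ , (λ (uj , _) → ¬ui (trans₁ uj (sym₁ ij₁))) ]′ ,
    (λ x → [ inj₁ ∘ inj₁ , (λ xi → inj₂ (inj₁ (xi , sym₂ vi))) ]′ (cover x)) ,
    (λ y → [ (λ yi → inj₂ (inj₁ (trans₂ yi (sym₂ vi)))) , (λ yj → inj₂ (inj₂ (inj₂ (yj , sym₂ vi , ij₁)))) ]′ (cover′ y))
  apart⇒glued (((acyclic₁ , ¬ui , cover) , ij₁) , inj₂ ((acyclic₂ , ¬ij₂ , cover′) , vj)) =
    acyclic₁ , acyclic₂ , ¬ij₂ ∘ proj₂ , [ ¬ui ∘ proj₁ , (λ (uj , _) → ¬ui (trans₁ uj (sym₁ ij₁))) ]′ ,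
    (λ x → [ inj₁ ∘ inj₁ , (λ xi → inj₂ (inj₂ (trans₁ xi ij₁ , sym₂ vj))) ]′ (cover x)) ,
    (λ y → [ (λ yi → inj₂ (inj₂ (inj₁ (yi , sym₂ vj , ij₁)))) , (λ yj → inj₂ (inj₁ (trans₂ yj (sym₂ vj)))) ]′ (cover′ y))

  withI-withJ⇒glued : S₁.UWithI × S₂.UWithJ → Glued
  withI-withJ⇒glued (((acyclic₁ , ¬ij₁ , cover) , ui) , ((acyclic₂ , ¬ij₂ , cover′) , vj)) =
    acyclic₁ , acyclic₂ , ¬ij₁ ∘ proj₁ ,
    [ (λ (_ , iv) → ¬ij₂ (trans₂ iv vj)) , (λ (uj , _) → ¬ij₁ (trans₁ (sym₁ ui) uj)) ]′ ,
    (λ x → [ (λ xi → inj₁ (inj₁ (trans₁ xi (sym₁ ui)))) , (λ xj → inj₂ (inj₂ (xj , sym₂ vj))) ]′ (cover x)) ,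
    (λ y → [ (λ yi → inj₁ (inj₁ (yi , sym₁ ui))) , (λ yj → inj₂ (inj₁ (trans₂ yj (sym₂ vj)))) ]′ (cover′ y))

module Decomposition {V₁ V₂ : Set} {r₁ : V₁ → V₁ → Set} {r₂ : V₂ → V₂ → Set}
  (r₁-equiv : IsEquivalence r₁) (r₁? : ∀ x y → Dec (r₁ x y))
  (r₂-equiv : IsEquivalence r₂) (r₂? : ∀ x y → Dec (r₂ x y))
  (A₁ A₂ : Set) (u i₁ j₁ : V₁) (v i₂ j₂ : V₂) where

  private
    module Half = HalfDecomposition r₁-equiv r₁? r₂-equiv r₂? A₁ A₂ u i₁ j₁ v i₂ j₂
    module Flip = HalfDecomposition r₂-equiv r₂? r₁-equiv r₁? A₂ A₁ v i₂ j₂ u i₁ j₁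
  open Half public using (module S₁; module S₂; Glued)
  open IsEquivalence r₁-equiv using () renaming (sym to sym₁)
  open IsEquivalence r₂-equiv using () renaming (sym to sym₂)

  TreeContracted ContractedTree ApartCase WithICase WithJCase Cases : Set
  TreeContracted = S₁.Tree × S₂.Contracted
  ContractedTree = S₁.Contracted × S₂.Tree
  ApartCase = S₁.UApart × (S₂.UWithI ⊎ S₂.UWithJ)
  WithICase = S₁.UWithI × (S₂.UApart ⊎ S₂.UWithJ)
  WithJCase = S₁.UWithJ × (S₂.UApart ⊎ S₂.UWithI)
  Cases = TreeContracted ⊎ ContractedTree ⊎ ApartCase ⊎ WithICase ⊎ WithJCase

  -- the cases are mutually exclusive, already on piece 1
  exclusive₁ : TreeContracted → ContractedTree ⊎ ApartCase ⊎ WithICase ⊎ WithJCase → ⊥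
  exclusive₁ (t , _) (inj₁ (c , _)) = S₁.tree-contracted t c
  exclusive₁ (t , _) (inj₂ (inj₁ (a , _))) = S₁.tree-apart t a
  exclusive₁ (t , _) (inj₂ (inj₂ (inj₁ (wi , _)))) = S₁.tree-withI t wi
  exclusive₁ (t , _) (inj₂ (inj₂ (inj₂ (wj , _)))) = S₁.tree-withJ t wj

  exclusive₂ : ContractedTree → ApartCase ⊎ WithICase ⊎ WithJCase → ⊥
  exclusive₂ (c , _) (inj₁ (a , _)) = S₁.contracted-apart c a
  exclusive₂ (c , _) (inj₂ (inj₁ (wi , _))) = S₁.contracted-withI c wi
  exclusive₂ (c , _) (inj₂ (inj₂ (wj , _))) = S₁.contracted-withJ c wj

  exclusive₃ : ApartCase → WithICase ⊎ WithJCase → ⊥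
  exclusive₃ (a , _) (inj₁ (wi , _)) = S₁.apart-withI a wi
  exclusive₃ (a , _) (inj₂ (wj , _)) = S₁.apart-withJ a wj

  exclusive₄ : WithICase → WithJCase → ⊥
  exclusive₄ (wi , _) (wj , _) = S₁.withI-withJ wi wj

  private
    swap : ∀ {A B : Set} → A ⊎ B → B ⊎ A
    swap = [ inj₂ , inj₁ ]′

    flip : Glued → Flip.Glued
    flip (acyclic₁ , acyclic₂ , ¬both , ¬uv , cover₁ , cover₂) =
      acyclic₂ , acyclic₁ , (λ (ij₂ , ij₁) → ¬both (ij₁ , ij₂)) ,
      [ (λ (vi , iu) → ¬uv (inj₁ (sym₁ iu , sym₂ vi))) , (λ (vj , ju) → ¬uv (inj₂ (sym₁ ju , sym₂ vj))) ]′ ,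
      swap ∘ cover₂ , swap ∘ cover₁

    unflip : Flip.Glued → Glued
    unflip (acyclic₂ , acyclic₁ , ¬both , ¬vu , cover₂ , cover₁) =
      acyclic₁ , acyclic₂ , (λ (ij₁ , ij₂) → ¬both (ij₂ , ij₁)) ,
      [ (λ (ui , iv) → ¬vu (inj₁ (sym₂ iv , sym₁ ui))) , (λ (uj , jv) → ¬vu (inj₂ (sym₂ jv , sym₁ uj))) ]′ ,
      swap ∘ cover₁ , swap ∘ cover₂

  glued⇒cases : Glued → Cases
  glued⇒cases g with r₁? i₁ j₁ | r₂? i₂ j₂
  ... | yes ij₁ | yes ij₂ = ⊥-elim (proj₁ (proj₂ (proj₂ g)) (ij₁ , ij₂))
  ... | yes ij₁ | no ¬ij₂ = [ inj₁ , inj₂ ∘ inj₂ ∘ inj₁ ]′ (Half.linked₁-only ij₁ ¬ij₂ g)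
  ... | no ¬ij₁ | yes ij₂ with Flip.linked₁-only ij₂ ¬ij₁ (flip g)
  ...   | inj₁ (tree₂ , contracted₁) = inj₂ (inj₁ (contracted₁ , tree₂))
  ...   | inj₂ (apart₂ , inj₁ withI₁) = inj₂ (inj₂ (inj₂ (inj₁ (withI₁ , inj₁ apart₂))))
  ...   | inj₂ (apart₂ , inj₂ withJ₁) = inj₂ (inj₂ (inj₂ (inj₂ (withJ₁ , inj₁ apart₂))))
  glued⇒cases g | no ¬ij₁ | no ¬ij₂ with Half.unlinked-split ¬ij₁ ¬ij₂ g
  ...   | inj₁ ui = let (withI₁ , withJ₂) = Half.unlinked-u∼i ¬ij₁ ¬ij₂ g ui in
                    inj₂ (inj₂ (inj₂ (inj₁ (withI₁ , inj₂ withJ₂))))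
  ...   | inj₂ vi = let (withI₂ , withJ₁) = Flip.unlinked-u∼i ¬ij₂ ¬ij₁ (flip g) vi in
                    inj₂ (inj₂ (inj₂ (inj₂ (withJ₁ , inj₂ withI₂))))

  cases⇒glued : Cases → Glued
  cases⇒glued (inj₁ c) = Half.tree-contracted⇒glued c
  cases⇒glued (inj₂ (inj₁ (contracted₁ , tree₂))) = unflip (Flip.tree-contracted⇒glued (tree₂ , contracted₁))
  cases⇒glued (inj₂ (inj₂ (inj₁ c))) = Half.apart⇒glued c
  cases⇒glued (inj₂ (inj₂ (inj₂ (inj₁ (withI₁ , inj₁ apart₂))))) = unflip (Flip.apart⇒glued (apart₂ , inj₁ withI₁))
  cases⇒glued (inj₂ (inj₂ (inj₂ (inj₁ (withI₁ , inj₂ withJ₂))))) = Half.withI-withJ⇒glued (withI₁ , withJ₂)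
  cases⇒glued (inj₂ (inj₂ (inj₂ (inj₂ (withJ₁ , inj₁ apart₂))))) = unflip (Flip.apart⇒glued (apart₂ , inj₂ withJ₁))
  cases⇒glued (inj₂ (inj₂ (inj₂ (inj₂ (withJ₁ , inj₂ withI₂))))) = unflip (Flip.withI-withJ⇒glued (withI₂ , withJ₁))

module GraphClasses (H : Graph) (reach? : ∀ S x y → Dec (Reach H S x y)) (u i j : V H) (S : Subset (m H)) =
  SideClasses (Reach-isEquivalence H S) (reach? S) (Acyclic H S) u i j

record ClassSizes (H : Graph) (reach? : ∀ S x y → Dec (Reach H S x y)) (u i j : V H) (a b c : ℕ) : Set where
  module Cl = GraphClasses H reach? u i j
  field
    apart withI withJ : ℕ
    count-apart : Counts Cl.UApart apart
    count-withI : Counts Cl.UWithI withI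
    count-withJ : Counts Cl.UWithJ withJ
    a≡ : a ≡ apart ℕ.+ withJ
    b≡ : b ≡ apart ℕ.+ withI
    c≡ : c ≡ withI ℕ.+ withJ

classSizes : ∀ H reach? (u i j : V H) {a b c} →
  NumTwoForests H u i a → NumTwoForests H u j b → NumTwoForests H i j c → ClassSizes H reach? u i j a b c
classSizes H reach? u i j Cui Cuj Cij = record
  { count-apart = proj₂ apart ; count-withI = proj₂ withI ; count-withJ = proj₂ withJ
  ; a≡ = Counts-unique Cui (Counts-⇔ (λ S → Cl.separates-ui⇐ S) (λ S → Cl.separates-ui⇒ S)
           (Counts-⊎ (λ S → Cl.apart-withJ S) (proj₂ apart) (proj₂ withJ)))
  ; b≡ = Counts-unique Cuj (Counts-⇔ (λ S → Cl.separates-uj⇐ S) (λ S → Cl.separates-uj⇒ S)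
           (Counts-⊎ (λ S → Cl.apart-withI S) (proj₂ apart) (proj₂ withI)))
  ; c≡ = Counts-unique Cij (Counts-⇔ (λ S → Cl.separates-ij⇐ S) (λ S → Cl.separates-ij⇒ S)
           (Counts-⊎ (λ S → Cl.withI-withJ S) (proj₂ withI) (proj₂ withJ))) }
  where
  module Cl = GraphClasses H reach? u i j
  apart : Σ ℕ (Counts Cl.UApart)
  apart = countDecidable (m H) Cl.UApart (λ S → Counts-decidable Cui S ×-dec reach? S i j)
  withI : Σ ℕ (Counts Cl.UWithI)
  withI = countDecidable (m H) Cl.UWithI (λ S → Counts-decidable Cij S ×-dec reach? S u i)
  withJ : Σ ℕ (Counts Cl.UWithJ)
  withJ = countDecidable (m H) Cl.UWithJ (λ S → Counts-decidable Cij S ×-dec reach? S u j)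

module GluedCount {G G₁ G₂ i₁ j₁ i₂ j₂} (sep : TwoSeparation G G₁ G₂ i₁ j₁ i₂ j₂) (u : V G₁) (v : V G₂)
  (reach₁? : ∀ S x y → Dec (Reach G₁ S x y)) (reach₂? : ∀ S x y → Dec (Reach G₂ S x y)) where

  open TwoSeparation sep

  trace₁ : Subset (m G) → Subset (m G₁)
  trace₁ = restrict ψ₁

  trace₂ : Subset (m G) → Subset (m G₂)
  trace₂ = restrict ψ₂

  fromTraces : Subset (m G₁) → Subset (m G₂) → Subset (m G)
  fromTraces S₁ S₂ = tabulate (λ f → [ (λ (a , _) → lookup S₁ a) , (λ (b , _) → lookup S₂ b) ]′ (E-cover f))

  trace₁-fromTraces : ∀ S₁ S₂ → trace₁ (fromTraces S₁ S₂) ≡ S₁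
  trace₁-fromTraces S₁ S₂ = trans (tabulate-cong at) (tabulate∘lookup S₁)
    where
    at : ∀ a → lookup (fromTraces S₁ S₂) (ψ₁ a) ≡ lookup S₁ a
    at a rewrite lookup∘tabulate (λ f → [ (λ (a , _) → lookup S₁ a) , (λ (b , _) → lookup S₂ b) ]′ (E-cover f)) (ψ₁ a)
      with E-cover (ψ₁ a)
    ... | inj₁ (a′ , eq) = cong (lookup S₁) (ψ₁-inj eq)
    ... | inj₂ (b , eq) = ⊥-elim (E-disj a b (sym eq))

  trace₂-fromTraces : ∀ S₁ S₂ → trace₂ (fromTraces S₁ S₂) ≡ S₂
  trace₂-fromTraces S₁ S₂ = trans (tabulate-cong at) (tabulate∘lookup S₂)
    where
    at : ∀ b → lookup (fromTraces S₁ S₂) (ψ₂ b) ≡ lookup S₂ b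
    at b rewrite lookup∘tabulate (λ f → [ (λ (a , _) → lookup S₁ a) , (λ (b , _) → lookup S₂ b) ]′ (E-cover f)) (ψ₂ b)
      with E-cover (ψ₂ b)
    ... | inj₁ (a , eq) = ⊥-elim (E-disj a b eq)
    ... | inj₂ (b′ , eq) = cong (lookup S₂) (ψ₂-inj eq)

  fromTraces-traces : ∀ F → fromTraces (trace₁ F) (trace₂ F) ≡ F
  fromTraces-traces F = trans (tabulate-cong at) (tabulate∘lookup F)
    where
    at : ∀ f → [ (λ (a , _) → lookup (trace₁ F) a) , (λ (b , _) → lookup (trace₂ F) b) ]′ (E-cover f) ≡ lookup F f
    at f with E-cover f
    ... | inj₁ (a , refl) = lookup∘tabulate (λ a → lookup F (ψ₁ a)) a
    ... | inj₂ (b , refl) = lookup∘tabulate (λ b → lookup F (ψ₂ b)) b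

  Counts-traces : ∀ {P₁ P₂ k₁ k₂} → Counts P₁ k₁ → Counts P₂ k₂ → Counts (λ F → P₁ (trace₁ F) × P₂ (trace₂ F)) (k₁ ℕ.* k₂)
  Counts-traces = Counts-× trace₁ trace₂ fromTraces trace₁-fromTraces trace₂-fromTraces fromTraces-traces

  module CasesAt (F : Subset (m G)) =
    Decomposition (Reach-isEquivalence G₁ (trace₁ F)) (reach₁? (trace₁ F)) (Reach-isEquivalence G₂ (trace₂ F)) (reach₂? (trace₂ F))
                  (Acyclic G₁ (trace₁ F)) (Acyclic G₂ (trace₂ F)) u i₁ j₁ v i₂ j₂

  countTwoForests : ∀ {t₁ t₂ f₁ f₂ a₁ b₁ c₁ a₂ b₂ c₂} →
    NumSpanningTrees G₁ t₁ → NumSpanningTrees G₂ t₂ →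
    Counts (λ S → ContractedTwoForest (Reach G₁ S) (Acyclic G₁ S) u i₁ j₁) f₁ →
    Counts (λ S → ContractedTwoForest (Reach G₂ S) (Acyclic G₂ S) v i₂ j₂) f₂ →
    (sizes₁ : ClassSizes G₁ reach₁? u i₁ j₁ a₁ b₁ c₁) (sizes₂ : ClassSizes G₂ reach₂? v i₂ j₂ a₂ b₂ c₂) →
    let open ClassSizes sizes₁ renaming (apart to x₁; withI to y₁; withJ to z₁)
        open ClassSizes sizes₂ renaming (apart to x₂; withI to y₂; withJ to z₂) in
    Counts (TwoForest G (φ₁ u) (φ₂ v))
      (t₁ ℕ.* f₂ ℕ.+ (f₁ ℕ.* t₂ ℕ.+ (x₁ ℕ.* (y₂ ℕ.+ z₂) ℕ.+ (y₁ ℕ.* (x₂ ℕ.+ z₂) ℕ.+ z₁ ℕ.* (x₂ ℕ.+ y₂)))))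
  countTwoForests T₁ T₂ C₁ C₂ sizes₁ sizes₂ =
    Counts-⇔ (λ F c → traces⇒twoForest sep (restrictTraces sep F) u v (CasesAt.cases⇒glued F c))
             (λ F t → CasesAt.glued⇒cases F (twoForest⇒traces sep (restrictTraces sep F) u v t))
      (Counts-⊎ (λ F → CasesAt.exclusive₁ F) (Counts-traces T₁ C₂)
      (Counts-⊎ (λ F → CasesAt.exclusive₂ F) (Counts-traces C₁ T₂)
      (Counts-⊎ (λ F → CasesAt.exclusive₃ F) (Counts-traces count-apart₁ (Counts-⊎ (λ S → Cl₂.withI-withJ S) count-withI₂ count-withJ₂))
      (Counts-⊎ (λ F → CasesAt.exclusive₄ F) (Counts-traces count-withI₁ (Counts-⊎ (λ S → Cl₂.apart-withJ S) count-apart₂ count-withJ₂))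
                                             (Counts-traces count-withJ₁ (Counts-⊎ (λ S → Cl₂.apart-withI S) count-apart₂ count-withI₂))))))
    where
    open ClassSizes sizes₁ using () renaming (count-apart to count-apart₁; count-withI to count-withI₁; count-withJ to count-withJ₁)
    open ClassSizes sizes₂ using () renaming (count-apart to count-apart₂; count-withI to count-withI₂; count-withJ to count-withJ₂)
    module Cl₂ = GraphClasses G₂ reach₂? v i₂ j₂

-- Connectivity in a finite graph is decidable up to double negation: a
-- double negation commutes with quantifiers over the finitely many edge
-- subsets and vertices.  This suffices because the final identity, an
-- equation between integers, is itself decidable.
¬¬-∀-Subset : ∀ {M} {P : Subset M → Set} → (∀ S → ¬ ¬ P S) → ¬ ¬ (∀ S → P S)
¬¬-∀-Subset {zero} ¬¬P ¬all = ¬¬P [] (λ p → ¬all λ { [] → p })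
¬¬-∀-Subset {suc M} {P} ¬¬P ¬all =
  ¬¬-∀-Subset {M} {P ∘ (true ∷_)} (¬¬P ∘ (true ∷_)) λ onTrue →
  ¬¬-∀-Subset {M} {P ∘ (false ∷_)} (¬¬P ∘ (false ∷_)) λ onFalse →
  ¬all λ { (true ∷ S) → onTrue S ; (false ∷ S) → onFalse S }

¬¬-∀-Fin : ∀ {n} {P : Fin n → Set} → (∀ x → ¬ ¬ P x) → ¬ ¬ (∀ x → P x)
¬¬-∀-Fin {zero} ¬¬P ¬all = ¬all λ ()
¬¬-∀-Fin {suc n} {P} ¬¬P ¬all =
  ¬¬P zero λ p₀ → ¬¬-∀-Fin {n} {P ∘ suc} (¬¬P ∘ suc) λ onSuc → ¬all λ { zero → p₀ ; (suc x) → onSuc x }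

¬¬-reach-decidable : ∀ (H : Graph) → ¬ ¬ (∀ S x y → Dec (Reach H S x y))
¬¬-reach-decidable H = ¬¬-∀-Subset λ S → ¬¬-∀-Fin λ x → ¬¬-∀-Fin λ y → ¬¬-excluded-middle

-- The arithmetic.  Over ℤ the identity of the theorem (doubled) follows
-- from the count of two-forests of G and the class decompositions
-- a = x + z, b = x + y, c = y + z on both sides.

DoubledIdentity : (fG f₁c f₂c t₁ t₂ a₁ b₁ c₁ a₂ b₂ c₂ : ℕ) → Set
DoubledIdentity fG f₁c f₂c t₁ t₂ a₁ b₁ c₁ a₂ b₂ c₂ =
  + 2 * + fG ≡
    + 2 * + f₁c * + t₂ + + 2 * + f₂c * + t₁
    + + a₁ * + b₂ + + b₁ * + a₂
    - + a₁ * + a₂ - + b₁ * + b₂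
    + (+ a₁ + + b₁) * + c₂
    + + c₁ * (+ a₂ + + b₂)
    - + c₁ * + c₂

ring-identity : ∀ (t₁ t₂ f₁ f₂ x₁ y₁ z₁ x₂ y₂ z₂ : ℤ) →
  + 2 * (t₁ * f₂ + (f₁ * t₂ + (x₁ * (y₂ + z₂) + (y₁ * (x₂ + z₂) + z₁ * (x₂ + y₂))))) ≡
    + 2 * f₁ * t₂ + + 2 * f₂ * t₁
    + (x₁ + z₁) * (x₂ + y₂) + (x₁ + y₁) * (x₂ + z₂)
    - (x₁ + z₁) * (x₂ + z₂) - (x₁ + y₁) * (x₂ + y₂)
    + ((x₁ + z₁) + (x₁ + y₁)) * (y₂ + z₂)
    + (y₁ + z₁) * ((x₂ + z₂) + (x₂ + y₂))
    - (y₁ + z₁) * (y₂ + z₂)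
ring-identity = solve-∀

doubledIdentity : ∀ {fG a₁ b₁ c₁ a₂ b₂ c₂} f₁c f₂c t₁ t₂ x₁ y₁ z₁ x₂ y₂ z₂ →
  fG ≡ t₁ ℕ.* f₂c ℕ.+ (f₁c ℕ.* t₂ ℕ.+ (x₁ ℕ.* (y₂ ℕ.+ z₂) ℕ.+ (y₁ ℕ.* (x₂ ℕ.+ z₂) ℕ.+ z₁ ℕ.* (x₂ ℕ.+ y₂)))) →
  a₁ ≡ x₁ ℕ.+ z₁ → b₁ ≡ x₁ ℕ.+ y₁ → c₁ ≡ y₁ ℕ.+ z₁ → a₂ ≡ x₂ ℕ.+ z₂ → b₂ ≡ x₂ ℕ.+ y₂ → c₂ ≡ y₂ ℕ.+ z₂ →
  DoubledIdentity fG f₁c f₂c t₁ t₂ a₁ b₁ c₁ a₂ b₂ c₂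
doubledIdentity f₁c f₂c t₁ t₂ x₁ y₁ z₁ x₂ y₂ z₂ refl refl refl refl refl refl refl =
  trans (cong (+ 2 *_) cast) (ring-identity (+ t₁) (+ t₂) (+ f₁c) (+ f₂c) (+ x₁) (+ y₁) (+ z₁) (+ x₂) (+ y₂) (+ z₂))
  where
  -- +_ preserves sums definitionally and products by pos-*
  cast : + (t₁ ℕ.* f₂c ℕ.+ (f₁c ℕ.* t₂ ℕ.+ (x₁ ℕ.* (y₂ ℕ.+ z₂) ℕ.+ (y₁ ℕ.* (x₂ ℕ.+ z₂) ℕ.+ z₁ ℕ.* (x₂ ℕ.+ y₂))))) ≡
         + t₁ * + f₂c + (+ f₁c * + t₂ + (+ x₁ * (+ y₂ + + z₂) + (+ y₁ * (+ x₂ + + z₂) + + z₁ * (+ x₂ + + y₂))))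
  cast = cong₂ _+_ (pos-* t₁ f₂c) (cong₂ _+_ (pos-* f₁c t₂)
           (cong₂ _+_ (pos-* x₁ (y₂ ℕ.+ z₂)) (cong₂ _+_ (pos-* y₁ (x₂ ℕ.+ z₂)) (pos-* z₁ (x₂ ℕ.+ y₂)))))

identityWithDeciders : ∀ {G G₁ G₂ i₁ j₁ i₂ j₂} (sep : TwoSeparation G G₁ G₂ i₁ j₁ i₂ j₂) (u : V G₁) (v : V G₂) →
  (∀ S x y → Dec (Reach G₁ S x y)) → (∀ S x y → Dec (Reach G₂ S x y)) →
  ∀ {fG f₁c f₂c t₁ t₂ a₁ b₁ c₁ a₂ b₂ c₂} →
  NumTwoForests G (TwoSeparation.φ₁ sep u) (TwoSeparation.φ₂ sep v) fG →
  NumTwoForests (contract G₁ i₁ j₁ (TwoSeparation.i≢j sep)) (contractV G₁ i₁ j₁ (TwoSeparation.i≢j sep) u)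
    (contractV G₁ i₁ j₁ (TwoSeparation.i≢j sep) i₁) f₁c →
  NumTwoForests (contract G₂ i₂ j₂ (i₂≢j₂ sep)) (contractV G₂ i₂ j₂ (i₂≢j₂ sep) v)
    (contractV G₂ i₂ j₂ (i₂≢j₂ sep) i₂) f₂c →
  NumSpanningTrees G₁ t₁ → NumSpanningTrees G₂ t₂ →
  NumTwoForests G₁ u i₁ a₁ → NumTwoForests G₁ u j₁ b₁ → NumTwoForests G₁ i₁ j₁ c₁ →
  NumTwoForests G₂ v i₂ a₂ → NumTwoForests G₂ v j₂ b₂ → NumTwoForests G₂ i₂ j₂ c₂ →
  DoubledIdentity fG f₁c f₂c t₁ t₂ a₁ b₁ c₁ a₂ b₂ c₂
identityWithDeciders {G} {G₁} {G₂} {i₁} {j₁} {i₂} {j₂} sep u v reach₁? reach₂? {f₁c = f₁c} {f₂c} {t₁} {t₂} CG Cf₁ Cf₂ T₁ T₂ Ca₁ Cb₁ Cc₁ Ca₂ Cb₂ Cc₂ =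
  doubledIdentity f₁c f₂c t₁ t₂ x₁ y₁ z₁ x₂ y₂ z₂ (Counts-unique CG countG) a≡₁ b≡₁ c≡₁ a≡₂ b≡₂ c≡₂
  where
  sizes₁ : ClassSizes G₁ reach₁? u i₁ j₁ _ _ _
  sizes₁ = classSizes G₁ reach₁? u i₁ j₁ Ca₁ Cb₁ Cc₁
  sizes₂ : ClassSizes G₂ reach₂? v i₂ j₂ _ _ _
  sizes₂ = classSizes G₂ reach₂? v i₂ j₂ Ca₂ Cb₂ Cc₂
  open ClassSizes sizes₁ using () renaming (apart to x₁; withI to y₁; withJ to z₁; a≡ to a≡₁; b≡ to b≡₁; c≡ to c≡₁)
  open ClassSizes sizes₂ using () renaming (apart to x₂; withI to y₂; withJ to z₂; a≡ to a≡₂; b≡ to b≡₂; c≡ to c≡₂)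
  countG : Counts (TwoForest G (TwoSeparation.φ₁ sep u) (TwoSeparation.φ₂ sep v))
             (t₁ ℕ.* f₂c ℕ.+ (f₁c ℕ.* t₂ ℕ.+ (x₁ ℕ.* (y₂ ℕ.+ z₂) ℕ.+ (y₁ ℕ.* (x₂ ℕ.+ z₂) ℕ.+ z₁ ℕ.* (x₂ ℕ.+ y₂)))))
  countG = GluedCount.countTwoForests sep u v reach₁? reach₂? T₁ T₂
             (contractionCounts G₁ i₁ j₁ (TwoSeparation.i≢j sep) u Cf₁) (contractionCounts G₂ i₂ j₂ (i₂≢j₂ sep) v Cf₂) sizes₁ sizes₂

corollary16 : (G G₁ G₂ : Graph) → Loopless G →
    (i₁ j₁ : V G₁) (i₂ j₂ : V G₂) →
    (sep : TwoSeparation G G₁ G₂ i₁ j₁ i₂ j₂) →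
    (u : V G₁) (v : V G₂) →
    (fG f₁c f₂c t₁ t₂ a₁ b₁ c₁ a₂ b₂ c₂ : ℕ) →
    NumTwoForests G (TwoSeparation.φ₁ sep u) (TwoSeparation.φ₂ sep v) fG →
    NumTwoForests (contract G₁ i₁ j₁ (TwoSeparation.i≢j sep))
      (contractV G₁ i₁ j₁ (TwoSeparation.i≢j sep) u)
      (contractV G₁ i₁ j₁ (TwoSeparation.i≢j sep) i₁) f₁c →
    NumTwoForests (contract G₂ i₂ j₂ (i₂≢j₂ sep))
      (contractV G₂ i₂ j₂ (i₂≢j₂ sep) v)
      (contractV G₂ i₂ j₂ (i₂≢j₂ sep) i₂) f₂c →
    NumSpanningTrees G₁ t₁ →
    NumSpanningTrees G₂ t₂ →
    NumTwoForests G₁ u i₁ a₁ →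
    NumTwoForests G₁ u j₁ b₁ →
    NumTwoForests G₁ i₁ j₁ c₁ →
    NumTwoForests G₂ v i₂ a₂ →
    NumTwoForests G₂ v j₂ b₂ →
    NumTwoForests G₂ i₂ j₂ c₂ →
    + 2 * + fG ≡
      + 2 * + f₁c * + t₂ + + 2 * + f₂c * + t₁
      + + a₁ * + b₂ + + b₁ * + a₂
      - + a₁ * + a₂ - + b₁ * + b₂
      + (+ a₁ + + b₁) * + c₂
      + + c₁ * (+ a₂ + + b₂)
      - + c₁ * + c₂
corollary16 G G₁ G₂ _ i₁ j₁ i₂ j₂ sep u v fG f₁c f₂c t₁ t₂ a₁ b₁ c₁ a₂ b₂ c₂ CG Cf₁ Cf₂ T₁ T₂ Ca₁ Cb₁ Cc₁ Ca₂ Cb₂ Cc₂ =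
  decidable-stable (_ ≟ℤ _) λ ¬identity →
    ¬¬-reach-decidable G₁ λ reach₁? →
    ¬¬-reach-decidable G₂ λ reach₂? →
    ¬identity (identityWithDeciders sep u v reach₁? reach₂? CG Cf₁ Cf₂ T₁ T₂ Ca₁ Cb₁ Cc₁ Ca₂ Cb₂ Cc₂)
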